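{- Let $\lambda\in\mathbb{F}_{q^n}\setminus\mathbb{F}_q$ with $\mathbb{F}_q(\lambda)=\mathbb{F}_{q^n}$, let $f(x)=a_0+a_1x+\dots+a_{n-1}x^{n-1}+x^n\in\mathbb{F}_q[x]$ be the minimal polynomial of $\lambda$ over $\mathbb{F}_q$ (set $a_n=1$), let $\delta=f'(\lambda)$, and let $1\le t\le n-1$. Let \[L=\{\langle(\alpha_0+\alpha_1\lambda+\dots+\alpha_{t-1}\lambda^{t-1},\ \beta_0+\beta_1\lambda+\dots+\beta_{n-t-1}\lambda^{n-t-1})\rangle_{\mathbb{F}_{q^n}}\colon \alpha_i,\beta_i\in\mathbb{F}_q \text{ not all zero}\}.\] Then $L$ is $\mathrm{PGL}(2,q^n)$-equivalent to $L_p=\{\langle(x,p(x))\rangle_{\mathbb{F}_{q^n}}\colon x\in\mathbb{F}_{q^n}^*\}$, where \[p(x)=\sum_{i=t}^{n-1}\lambda^i\,\mathrm{Tr}_{q^n/q}((\lambda^i)^*x)=\sum_{j=0}^{n-1}A_jx^{q^j},\qquad A_j=\frac{1}{\delta^{q^j}}\sum_{i=t}^{n-1}\sum_{h=1}^{n-i}\lambda^{i+(h-1)q^j}a_{i+h}^{q^j},\] and $((\lambda^0)^*,\dots,(\lambda^{n-1})^*)$ denotes the dual basis of $(1,\lambda,\dots,\lambda^{n-1})$.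
   Context: $\mathrm{Tr}_{q^n/q}(a)=\sum_{i=0}^{n-1}a^{q^i}$. Two ordered $\mathbb{F}_q$-bases $(\xi_i)$, $(\xi_i^*)$ of $\mathbb{F}_{q^n}$ are dual if $\mathrm{Tr}_{q^n/q}(\xi_i\xi_j^*)=\delta_{ij}$. Points of $\mathrm{PG}(1,q^n)$ are $\langle \mathbf v\rangle_{\mathbb{F}_{q^n}}$, $\mathbf v\in\mathbb{F}_{q^n}^2\setminus\{\mathbf 0\}$. -}

module Defs where

open import Level using (Level; _⊔_; suc)
import Algebra.Bundles
open Algebra.Bundles using (CommutativeRing)
open import Data.Nat as ℕ using (ℕ; zero; _∸_; _<_; _≤_)
open import Data.Nat.Primality using (Prime)
open import Data.Fin using (Fin)
open import Data.Product using (Σ; ∃; _×_; _,_)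
open import Data.Sum using (_⊎_)
open import Relation.Nullary using (¬_)
open import Relation.Binary.PropositionalEquality using (_≡_)

record Field (c ℓ : Level) : Set (Level.suc (c ⊔ ℓ)) where
  field
    commRing : CommutativeRing c ℓ
  open CommutativeRing commRing public
  field
    _⁻¹     : Carrier → Carrier
    1≉0     : ¬ (1# ≈ 0#)
    ⁻¹-inv  : ∀ x → ¬ (x ≈ 0#) → x * (x ⁻¹) ≈ 1#

IsPrimePower : ℕ → Set
IsPrimePower q = Σ ℕ λ p → Σ ℕ λ k → Prime p × 1 ≤ k × q ≡ p ℕ.^ k

module FieldTheory {c ℓ} (K : Field c ℓ) where
  open Field K public
  open import Algebra.Definitions.RawSemiring (Algebra.Bundles.Semiring.rawSemiring semiring) using (_^_) renaming (_×_ to _·ℕ_) public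

  HasSize : ℕ → Set (c ⊔ ℓ)
  HasSize N = Σ (Fin N → Carrier) λ e →
    (∀ i j → e i ≈ e j → i ≡ j) × (∀ x → ∃ λ i → e i ≈ x)

  sumℕ : ℕ → (ℕ → Carrier) → Carrier
  sumℕ zero    f = 0#
  sumℕ (ℕ.suc m) f = sumℕ m f + f m

  module OverSubfield (q n : ℕ) where
    InFq : Carrier → Set ℓ
    InFq x = x ^ q ≈ x

    Tr : Carrier → Carrier
    Tr a = sumℕ n (λ i → a ^ (q ℕ.^ i))

    evalPoly : ℕ → (ℕ → Carrier) → Carrier → Carrier
    evalPoly d cs x = sumℕ (ℕ.suc d) (λ i → cs i * (x ^ i))

    Generates : Carrier → Set (c ⊔ ℓ)
    Generates lam = ∀ y → Σ ℕ λ m → Σ (ℕ → Carrier) λ cs →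
      (∀ i → InFq (cs i)) × (y ≈ sumℕ m (λ i → cs i * (lam ^ i)))

    MonicOver : ℕ → (ℕ → Carrier) → Set ℓ
    MonicOver d a = (a d ≈ 1#) × (∀ i → i < d → InFq (a i))

    IsMinimalPolynomial : (ℕ → Carrier) → Carrier → Set (c ⊔ ℓ)
    IsMinimalPolynomial a lam =
      MonicOver n a × (evalPoly n a lam ≈ 0#) ×
      (∀ d b → MonicOver d b → evalPoly d b lam ≈ 0# → n ≤ d)

    derivAt : (ℕ → Carrier) → Carrier → Carrier
    derivAt a lam = sumℕ n (λ i → (ℕ.suc i ·ℕ a (ℕ.suc i)) * (lam ^ i))

    kδ : ℕ → ℕ → Carrier
    kδ i j with i ℕ.≟ j
    ... | Relation.Nullary.yes _ = 1#
    ... | Relation.Nullary.no  _ = 0#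

    IsDualBasisOfPowers : Carrier → (ℕ → Carrier) → Set ℓ
    IsDualBasisOfPowers lam ds = ∀ i j → i < n → j < n → Tr ((lam ^ i) * ds j) ≈ kδ i j

    pPoly : Carrier → (ℕ → Carrier) → ℕ → Carrier → Carrier
    pPoly lam ds t x = sumℕ (n ∸ t) (λ k → (lam ^ (t ℕ.+ k)) * Tr (ds (t ℕ.+ k) * x))

    Acoef : Carrier → (ℕ → Carrier) → Carrier → ℕ → ℕ → Carrier
    Acoef lam a δ t j =
      ((δ ^ (q ℕ.^ j)) ⁻¹) *
      sumℕ (n ∸ t) (λ k → let i = t ℕ.+ k in
        sumℕ (n ∸ i) (λ h → (lam ^ (i ℕ.+ h ℕ.* (q ℕ.^ j))) * (a (i ℕ.+ ℕ.suc h) ^ (q ℕ.^ j))))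

    linPoly : (ℕ → Carrier) → Carrier → Carrier
    linPoly A x = sumℕ n (λ j → A j * (x ^ (q ℕ.^ j)))

    Vec2 : Set c
    Vec2 = Carrier × Carrier

    record Mat2 : Set c where
      constructor mat
      field m11 m12 m21 m22 : Carrier

    det : Mat2 → Carrier
    det (mat a b c' d) = a * d - b * c'

    act : Mat2 → Vec2 → Vec2
    act (mat a b c' d) (u , v) = (a * u + b * v , c' * u + d * v)

    SamePoint : Vec2 → Vec2 → Set (c ⊔ ℓ)
    SamePoint (u₁ , u₂) (v₁ , v₂) = Σ Carrier λ μ → ¬ (μ ≈ 0#) × (u₁ ≈ μ * v₁) × (u₂ ≈ μ * v₂)

    Lvec : Carrier → ℕ → (ℕ → Carrier) → (ℕ → Carrier) → Vec2
    Lvec lam t α β = (sumℕ t (λ i → α i * (lam ^ i)) , sumℕ (n ∸ t) (λ i → β i * (lam ^ i)))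

    AdmissibleCoeffs : ℕ → (ℕ → Carrier) → (ℕ → Carrier) → Set ℓ
    AdmissibleCoeffs t α β =
      (∀ i → i < t → InFq (α i)) × (∀ i → i < n ∸ t → InFq (β i)) ×
      ((∃ λ i → i < t × ¬ (α i ≈ 0#)) ⊎ (∃ λ i → i < n ∸ t × ¬ (β i ≈ 0#)))

    MapsLOntoLp : Mat2 → Carrier → ℕ → (Carrier → Carrier) → Set (c ⊔ ℓ)
    MapsLOntoLp M lam t p =
      (∀ α β → AdmissibleCoeffs t α β →
         Σ Carrier λ x → ¬ (x ≈ 0#) × SamePoint (act M (Lvec lam t α β)) (x , p x)) ×
      (∀ x → ¬ (x ≈ 0#) →
         Σ (ℕ → Carrier) λ α → Σ (ℕ → Carrier) λ β → AdmissibleCoeffs t α β ×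
           SamePoint (act M (Lvec lam t α β)) (x , p x))

    PGLEquivalentToLp : Carrier → ℕ → (Carrier → Carrier) → Set (c ⊔ ℓ)
    PGLEquivalentToLp lam t p = Σ Mat2 λ M → ¬ (det M ≈ 0#) × MapsLOntoLp M lam t p

-- Writing every x ∈ F_{q^n} as Σ_i Tr((λ^i)^* x) λ^i with coordinates in F_q, the matrix
-- (u, v) ↦ (u + λ^t v, λ^t v) sends the point of L with coordinates (α, β) to ⟨(x, p(x))⟩,
-- where x is the element with these coordinates; conversely every x ≠ 0 arises this way.
-- For the closed form of p one identifies the dual basis: (λ^i)^* = g_i / f′(λ), where
-- f(X) / (X − λ) = Σ_i g_i X^i, which is Lagrange interpolation at the n distinct conjugates
-- λ^{q^j}; expanding the trace then yields the coefficients A_j. The facts about F_{q^n} this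
-- needs (its characteristic divides q, Frobenius is additive, λ^{q^n} = λ, the conjugates are
-- distinct) follow from F_{q^n} having exactly q^n elements.

module Submission where

open import Defs
open import Level using (_⊔_)
open import Algebra.Bundles using (CommutativeRing)
open import Data.Nat using (ℕ; zero; suc; _<_; _≤_; _∸_; s≤s; z≤n; _!)
import Data.Nat as ℕ
import Data.Nat.Properties as ℕ
open import Data.Nat.Divisibility using (_∣_; divides; ∣⇒≤; ∣1⇒≡1)
open import Data.Nat.Primality using (Prime; euclidsLemma; ¬prime[1]; ¬prime[0]; prime⇒nonTrivial)
open import Data.Nat.Combinatorics using (_C_; k![n∸k]!∣n!; nCn≡1)
open import Data.Nat.Combinatorics.Specification using (nCk≡n!/k![n-k]!)
open import Data.Nat.DivMod using (m/n*n≡m)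
open import Data.Integer as ℤ using (ℤ; +_; -[1+_]; _⊖_; sign; ∣_∣; _◃_)
import Data.Integer.Properties as ℤ
open import Data.Sign as Sign using (Sign)
open import Data.Fin as Fin using (Fin; toℕ)
import Data.Fin.Properties as Fin
open import Data.Fin.Permutation using (permutation)
open import Data.Maybe using (Maybe; just; nothing)
open import Data.Product using (Σ; _,_; _×_; proj₁; proj₂)
open import Data.Sum using (_⊎_; inj₁; inj₂; [_,_]′)
open import Data.Empty using (⊥; ⊥-elim)
open import Relation.Nullary using (¬_; yes; no; Dec)
open import Relation.Binary.Definitions using (tri<; tri≈; tri>)
open import Relation.Binary.PropositionalEquality as ≡ using (_≡_)
open import Function using (_∘_)

-- Algebra.Solver.Ring needs a coefficient ring with decidable equality;
-- ℤ maps into every commutative ring.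
module ℤ-RingSolver {c ℓ} (R : CommutativeRing c ℓ) where
  open CommutativeRing R
  open import Algebra.Solver.Ring.AlmostCommutativeRing
  open import Algebra.Properties.Semiring.Mult semiring using (×-homo-+; ×1-homo-*) renaming (_×_ to _·ℕ_)
  open import Algebra.Properties.Ring ring using (-‿involutive; -‿distribˡ-*; -‿distribʳ-*; -‿+-comm; -0#≈0#)
  open import Relation.Binary.Reasoning.Setoid setoid

  ℕ⟶R : ℕ → Carrier
  ℕ⟶R n = n ·ℕ 1#

  signed : Sign → Carrier → Carrier
  signed Sign.+ x = x
  signed Sign.- x = - x

  ℤ⟶R : ℤ → Carrier
  ℤ⟶R (+ n)     = ℕ⟶R n
  ℤ⟶R -[1+ n ] = - ℕ⟶R (suc n)

  ⊖-homo : ∀ m n → ℤ⟶R (m ⊖ n) ≈ ℕ⟶R m - ℕ⟶R n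
  ⊖-homo m       zero    = sym (trans (+-congˡ -0#≈0#) (+-identityʳ _))
  ⊖-homo zero    (suc n) = sym (+-identityˡ _)
  ⊖-homo (suc m) (suc n) = begin
    ℤ⟶R (suc m ⊖ suc n)           ≡⟨ ≡.cong ℤ⟶R (ℤ.[1+m]⊖[1+n]≡m⊖n m n) ⟩
    ℤ⟶R (m ⊖ n)                   ≈⟨ ⊖-homo m n ⟩
    ℕ⟶R m - ℕ⟶R n                 ≈⟨ shift (ℕ⟶R m) (ℕ⟶R n) ⟩
    (1# + ℕ⟶R m) - (1# + ℕ⟶R n)   ∎
    where
    shift : ∀ a b → a - b ≈ (1# + a) - (1# + b)
    shift a b = begin
      a - b                  ≈⟨ +-congʳ (sym (+-identityˡ a)) ⟩
      (0# + a) - b           ≈⟨ +-congʳ (+-congʳ (sym (-‿inverseʳ 1#))) ⟩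
      ((1# - 1#) + a) - b    ≈⟨ +-congʳ (+-assoc _ _ _) ⟩
      (1# + (- 1# + a)) - b  ≈⟨ +-congʳ (+-congˡ (+-comm _ _)) ⟩
      (1# + (a - 1#)) - b    ≈⟨ +-congʳ (sym (+-assoc _ _ _)) ⟩
      ((1# + a) - 1#) - b    ≈⟨ +-assoc _ _ _ ⟩
      (1# + a) + (- 1# - b)  ≈⟨ +-congˡ (-‿+-comm 1# b) ⟩
      (1# + a) - (1# + b)    ∎

  ◃-homo : ∀ s n → ℤ⟶R (s ◃ n) ≈ signed s (ℕ⟶R n)
  ◃-homo Sign.+ zero    = refl
  ◃-homo Sign.- zero    = sym -0#≈0#
  ◃-homo Sign.+ (suc n) = refl
  ◃-homo Sign.- (suc n) = refl

  sign-abs : ∀ i → ℤ⟶R i ≈ signed (sign i) (ℕ⟶R ∣ i ∣)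
  sign-abs (+ n)     = refl
  sign-abs -[1+ n ] = refl

  signed-cong : ∀ s {x y} → x ≈ y → signed s x ≈ signed s y
  signed-cong Sign.+ e = e
  signed-cong Sign.- e = -‿cong e

  signed-* : ∀ s t x y → signed (s Sign.* t) (x * y) ≈ signed s x * signed t y
  signed-* Sign.+ Sign.+ x y = refl
  signed-* Sign.+ Sign.- x y = -‿distribʳ-* x y
  signed-* Sign.- Sign.+ x y = -‿distribˡ-* x y
  signed-* Sign.- Sign.- x y = begin
    x * y         ≈⟨ sym (*-congʳ (-‿involutive x)) ⟩
    (- - x) * y   ≈⟨ sym (-‿distribˡ-* (- x) y) ⟩
    - (- x * y)   ≈⟨ -‿distribʳ-* (- x) y ⟩
    - x * - y     ∎

  +-homo : ∀ i j → ℤ⟶R (i ℤ.+ j) ≈ ℤ⟶R i + ℤ⟶R j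
  +-homo -[1+ m ] -[1+ n ] = begin
    - ℕ⟶R (suc (suc (m ℕ.+ n)))       ≈⟨ -‿cong (+-congˡ (×-homo-+ 1# (suc m) n)) ⟩
    - (1# + (ℕ⟶R (suc m) + ℕ⟶R n))    ≈⟨ -‿cong (sym (+-assoc _ _ _)) ⟩
    - ((1# + ℕ⟶R (suc m)) + ℕ⟶R n)    ≈⟨ -‿cong (+-congʳ (+-comm _ _)) ⟩
    - ((ℕ⟶R (suc m) + 1#) + ℕ⟶R n)    ≈⟨ -‿cong (+-assoc _ _ _) ⟩
    - (ℕ⟶R (suc m) + ℕ⟶R (suc n))     ≈⟨ sym (-‿+-comm _ _) ⟩
    - ℕ⟶R (suc m) - ℕ⟶R (suc n)       ∎
  +-homo -[1+ m ] (+ n)    = trans (⊖-homo n (suc m)) (+-comm _ _)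
  +-homo (+ m)    -[1+ n ] = ⊖-homo m (suc n)
  +-homo (+ m)    (+ n)    = ×-homo-+ 1# m n

  *-homo : ∀ i j → ℤ⟶R (i ℤ.* j) ≈ ℤ⟶R i * ℤ⟶R j
  *-homo i j = begin
    ℤ⟶R (sign i Sign.* sign j ◃ ∣ i ∣ ℕ.* ∣ j ∣)              ≈⟨ ◃-homo (sign i Sign.* sign j) (∣ i ∣ ℕ.* ∣ j ∣) ⟩
    signed (sign i Sign.* sign j) (ℕ⟶R (∣ i ∣ ℕ.* ∣ j ∣))     ≈⟨ signed-cong (sign i Sign.* sign j) (×1-homo-* ∣ i ∣ ∣ j ∣) ⟩
    signed (sign i Sign.* sign j) (ℕ⟶R ∣ i ∣ * ℕ⟶R ∣ j ∣)     ≈⟨ signed-* (sign i) (sign j) _ _ ⟩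
    signed (sign i) (ℕ⟶R ∣ i ∣) * signed (sign j) (ℕ⟶R ∣ j ∣) ≈⟨ sym (*-cong (sign-abs i) (sign-abs j)) ⟩
    ℤ⟶R i * ℤ⟶R j                                             ∎

  -‿homo : ∀ i → ℤ⟶R (ℤ.- i) ≈ - ℤ⟶R i
  -‿homo -[1+ n ]  = sym (-‿involutive _)
  -‿homo (+ zero)  = sym -0#≈0#
  -‿homo (+ suc n) = refl

  ℤ⟶R-morphism : ℤ.+-*-rawRing -Raw-AlmostCommutative⟶ fromCommutativeRing R
  ℤ⟶R-morphism = record
    { ⟦_⟧ = ℤ⟶R ; +-homo = +-homo ; *-homo = *-homo ; -‿homo = -‿homo
    ; 0-homo = refl ; 1-homo = +-identityʳ 1# }

  ≡⇒ℤ⟶R-≈ : ∀ i j → Maybe (ℤ⟶R i ≈ ℤ⟶R j)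
  ≡⇒ℤ⟶R-≈ i j with i ℤ.≟ j
  ... | yes ≡.refl = just refl
  ... | no _       = nothing

  open import Algebra.Solver.Ring ℤ.+-*-rawRing (fromCommutativeRing R) ℤ⟶R-morphism ≡⇒ℤ⟶R-≈ public

module FieldProperties {c ℓ} (K : Field c ℓ) where
  open FieldTheory K
  open ℤ-RingSolver commRing using (solve; _:=_; _:+_; _:*_; :-_; _:-_; con)
  open import Relation.Binary.Reasoning.Setoid setoid
  open import Algebra.Properties.Ring ring using (-‿distribˡ-*; -‿+-comm; -0#≈0#)
  open import Algebra.Properties.AbelianGroup +-abelianGroup public
    using () renaming (x∙y⁻¹≈ε⇒x≈y to x-y≈0⇒x≈y; x≈y⇒x∙y⁻¹≈ε to x≈y⇒x-y≈0; ∙-cancelˡ to +-cancelˡ)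
  open import Algebra.Properties.Semiring.Exp semiring using (^-congˡ)

  ⁻¹-*-cancelˡ : ∀ {x} → ¬ (x ≈ 0#) → ∀ y → x ⁻¹ * (x * y) ≈ y
  ⁻¹-*-cancelˡ {x} x≉0 y = begin
    x ⁻¹ * (x * y)   ≈⟨ solve 3 (λ x i y → i :* (x :* y) := (x :* i) :* y) refl x (x ⁻¹) y ⟩
    (x * x ⁻¹) * y   ≈⟨ *-congʳ (⁻¹-inv x x≉0) ⟩
    1# * y           ≈⟨ *-identityˡ y ⟩
    y                ∎

  *-cancelˡ-≉0 : ∀ {x y z} → ¬ (x ≈ 0#) → x * y ≈ x * z → y ≈ z
  *-cancelˡ-≉0 {x} {y} {z} x≉0 e = begin
    y               ≈⟨ sym (⁻¹-*-cancelˡ x≉0 y) ⟩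
    x ⁻¹ * (x * y)  ≈⟨ *-congˡ e ⟩
    x ⁻¹ * (x * z)  ≈⟨ ⁻¹-*-cancelˡ x≉0 z ⟩
    z               ∎

  *-cancelʳ-≉0 : ∀ {x y z} → ¬ (x ≈ 0#) → y * x ≈ z * x → y ≈ z
  *-cancelʳ-≉0 x≉0 e = *-cancelˡ-≉0 x≉0 (trans (*-comm _ _) (trans e (*-comm _ _)))

  x≉0∧x*y≈0⇒y≈0 : ∀ {x y} → ¬ (x ≈ 0#) → x * y ≈ 0# → y ≈ 0#
  x≉0∧x*y≈0⇒y≈0 {x} x≉0 e = *-cancelˡ-≉0 x≉0 (trans e (sym (zeroʳ x)))

  *-≉0 : ∀ {x y} → ¬ (x ≈ 0#) → ¬ (y ≈ 0#) → ¬ (x * y ≈ 0#)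
  *-≉0 x≉0 y≉0 e = y≉0 (x≉0∧x*y≈0⇒y≈0 x≉0 e)

  ^-≉0 : ∀ {x} n → ¬ (x ≈ 0#) → ¬ (x ^ n ≈ 0#)
  ^-≉0 zero    x≉0 = 1≉0
  ^-≉0 (suc n) x≉0 = *-≉0 x≉0 (^-≉0 n x≉0)

  ⁻¹-unique : ∀ {x y} → ¬ (x ≈ 0#) → x * y ≈ 1# → y ≈ x ⁻¹
  ⁻¹-unique {x} x≉0 xy≈1 = *-cancelˡ-≉0 x≉0 (trans xy≈1 (sym (⁻¹-inv x x≉0)))

  1^n≈1 : ∀ n → 1# ^ n ≈ 1#
  1^n≈1 zero    = refl
  1^n≈1 (suc n) = trans (*-identityˡ _) (1^n≈1 n)

  0^n≈0 : ∀ n → 0 < n → 0# ^ n ≈ 0#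
  0^n≈0 (suc n) _ = zeroˡ _

  sumℕ-cong : ∀ m {f g : ℕ → Carrier} → (∀ i → i < m → f i ≈ g i) → sumℕ m f ≈ sumℕ m g
  sumℕ-cong zero    f≈g = refl
  sumℕ-cong (suc m) f≈g = +-cong (sumℕ-cong m (λ i i<m → f≈g i (ℕ.m<n⇒m<1+n i<m))) (f≈g m (ℕ.n<1+n m))

  sumℕ-zero : ∀ m {f : ℕ → Carrier} → (∀ i → i < m → f i ≈ 0#) → sumℕ m f ≈ 0#
  sumℕ-zero zero    f≈0 = refl
  sumℕ-zero (suc m) f≈0 = trans (+-cong (sumℕ-zero m (λ i i<m → f≈0 i (ℕ.m<n⇒m<1+n i<m))) (f≈0 m (ℕ.n<1+n m))) (+-identityʳ 0#)

  sumℕ-+ : ∀ m (f g : ℕ → Carrier) → sumℕ m (λ i → f i + g i) ≈ sumℕ m f + sumℕ m g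
  sumℕ-+ zero    f g = sym (+-identityˡ 0#)
  sumℕ-+ (suc m) f g = begin
    sumℕ m (λ i → f i + g i) + (f m + g m)  ≈⟨ +-congʳ (sumℕ-+ m f g) ⟩
    (sumℕ m f + sumℕ m g) + (f m + g m)     ≈⟨ solve 4 (λ a b c d → (a :+ b) :+ (c :+ d) := (a :+ c) :+ (b :+ d)) refl _ _ _ _ ⟩
    (sumℕ m f + f m) + (sumℕ m g + g m)     ∎

  sumℕ-neg : ∀ m (f : ℕ → Carrier) → sumℕ m (λ i → - f i) ≈ - sumℕ m f
  sumℕ-neg zero    f = sym -0#≈0#
  sumℕ-neg (suc m) f = trans (+-congʳ (sumℕ-neg m f)) (-‿+-comm _ _)

  *-distribˡ-sumℕ : ∀ m x (f : ℕ → Carrier) → x * sumℕ m f ≈ sumℕ m (λ i → x * f i)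
  *-distribˡ-sumℕ zero    x f = zeroʳ x
  *-distribˡ-sumℕ (suc m) x f = trans (distribˡ x _ _) (+-congʳ (*-distribˡ-sumℕ m x f))

  *-distribʳ-sumℕ : ∀ m x (f : ℕ → Carrier) → sumℕ m f * x ≈ sumℕ m (λ i → f i * x)
  *-distribʳ-sumℕ m x f = trans (*-comm _ x) (trans (*-distribˡ-sumℕ m x f) (sumℕ-cong m (λ i _ → *-comm x (f i))))

  sumℕ-head : ∀ m (f : ℕ → Carrier) → sumℕ (suc m) f ≈ f 0 + sumℕ m (f ∘ suc)
  sumℕ-head zero    f = trans (+-identityˡ _) (sym (+-identityʳ _))
  sumℕ-head (suc m) f = trans (+-congʳ (sumℕ-head m f)) (+-assoc _ _ _)

  sumℕ-split : ∀ a b (f : ℕ → Carrier) → sumℕ (b ℕ.+ a) f ≈ sumℕ a f + sumℕ b (λ k → f (a ℕ.+ k))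
  sumℕ-split a zero    f = sym (+-identityʳ _)
  sumℕ-split a (suc b) f = begin
    sumℕ (b ℕ.+ a) f + f (b ℕ.+ a)                          ≈⟨ +-cong (sumℕ-split a b f) (reflexive (≡.cong f (ℕ.+-comm b a))) ⟩
    (sumℕ a f + sumℕ b (λ k → f (a ℕ.+ k))) + f (a ℕ.+ b)  ≈⟨ +-assoc _ _ _ ⟩
    sumℕ a f + sumℕ (suc b) (λ k → f (a ℕ.+ k))             ∎

  sumℕ-comm : ∀ m k (F : ℕ → ℕ → Carrier) →
    sumℕ m (λ i → sumℕ k (F i)) ≈ sumℕ k (λ j → sumℕ m (λ i → F i j))
  sumℕ-comm zero    k F = sym (sumℕ-zero k (λ _ _ → refl))
  sumℕ-comm (suc m) k F = trans (+-congʳ (sumℕ-comm m k F)) (sym (sumℕ-+ k _ (F m)))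

  sumℕ-single : ∀ m {f : ℕ → Carrier} l → l < m → (∀ i → i < m → ¬ i ≡ l → f i ≈ 0#) → sumℕ m f ≈ f l
  sumℕ-single (suc m) {f} l l<1+m f≈0 with l ℕ.≟ m
  ... | yes ≡.refl = begin
    sumℕ l f + f l  ≈⟨ +-congʳ (sumℕ-zero l (λ i i<l → f≈0 i (ℕ.m<n⇒m<1+n i<l) (ℕ.<⇒≢ i<l))) ⟩
    0# + f l        ≈⟨ +-identityˡ _ ⟩
    f l             ∎
  ... | no l≢m = begin
    sumℕ m f + f m  ≈⟨ +-cong (sumℕ-single m l l<m (λ i i<m → f≈0 i (ℕ.m<n⇒m<1+n i<m))) (f≈0 m (ℕ.n<1+n m) (l≢m ∘ ≡.sym)) ⟩
    f l + 0#        ≈⟨ +-identityʳ _ ⟩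
    f l             ∎
    where l<m = ℕ.≤∧≢⇒< (ℕ.≤-pred l<1+m) l≢m

  eval : ℕ → (ℕ → Carrier) → Carrier → Carrier
  eval L cs x = sumℕ L (λ i → cs i * x ^ i)

  eval-cong : ∀ L {cs ds : ℕ → Carrier} {x y} → (∀ i → i < L → cs i ≈ ds i) → x ≈ y → eval L cs x ≈ eval L ds y
  eval-cong L cs≈ds x≈y = sumℕ-cong L (λ i i<L → *-cong (cs≈ds i i<L) (^-congˡ i x≈y))

  eval-+ : ∀ L (f g : ℕ → Carrier) x → eval L (λ i → f i + g i) x ≈ eval L f x + eval L g x
  eval-+ L f g x = trans (sumℕ-cong L (λ i _ → distribʳ _ _ _)) (sumℕ-+ L _ _)

  eval-neg : ∀ L (f : ℕ → Carrier) x → eval L (λ i → - f i) x ≈ - eval L f x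
  eval-neg L f x = trans (sumℕ-cong L (λ i _ → sym (-‿distribˡ-* _ _))) (sumℕ-neg L _)

  eval-- : ∀ L (f g : ℕ → Carrier) x → eval L (λ i → f i - g i) x ≈ eval L f x - eval L g x
  eval-- L f g x = trans (eval-+ L f _ x) (+-congˡ (eval-neg L g x))

  eval-*ˡ : ∀ L s (f : ℕ → Carrier) x → eval L (λ i → s * f i) x ≈ s * eval L f x
  eval-*ˡ L s f x = trans (sumℕ-cong L (λ i _ → *-assoc _ _ _)) (sym (*-distribˡ-sumℕ L s _))

  eval-sumℕ : ∀ L m (F : ℕ → ℕ → Carrier) (w : ℕ → Carrier) x →
    eval L (λ i → sumℕ m (λ j → F j i * w j)) x ≈ sumℕ m (λ j → w j * eval L (F j) x)
  eval-sumℕ L m F w x = begin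
    sumℕ L (λ i → sumℕ m (λ j → F j i * w j) * x ^ i)    ≈⟨ sumℕ-cong L (λ i _ → *-distribʳ-sumℕ m _ _) ⟩
    sumℕ L (λ i → sumℕ m (λ j → (F j i * w j) * x ^ i))  ≈⟨ sumℕ-comm L m _ ⟩
    sumℕ m (λ j → sumℕ L (λ i → (F j i * w j) * x ^ i))  ≈⟨ sumℕ-cong m (λ j _ → trans (sumℕ-cong L (λ i _ → *-congʳ (*-comm _ _))) (eval-*ˡ L (w j) (F j) x)) ⟩
    sumℕ m (λ j → w j * eval L (F j) x)                   ∎

  eval-horner : ∀ L cs x → eval (suc L) cs x ≈ cs 0 + x * eval L (cs ∘ suc) x
  eval-horner L cs x = begin
    eval (suc L) cs x                                  ≈⟨ sumℕ-head L _ ⟩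
    cs 0 * 1# + sumℕ L (λ i → cs (suc i) * (x * x ^ i)) ≈⟨ +-cong (*-identityʳ _) (sumℕ-cong L (λ i _ → x-comm _ _ _)) ⟩
    cs 0 + sumℕ L (λ i → x * (cs (suc i) * x ^ i))      ≈⟨ +-congˡ (sym (*-distribˡ-sumℕ L x _)) ⟩
    cs 0 + x * eval L (cs ∘ suc) x                      ∎
    where
    x-comm : ∀ a x y → a * (x * y) ≈ x * (a * y)
    x-comm = solve 3 (λ a x y → a :* (x :* y) := x :* (a :* y)) refl

  -- Coefficients of the quotient of Σ_{i<L} cs_i X^i by X - r (synthetic division).
  quotient : ℕ → (ℕ → Carrier) → Carrier → ℕ → Carrier
  quotient zero    cs r i       = 0#
  quotient (suc L) cs r zero    = eval L (cs ∘ suc) r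
  quotient (suc L) cs r (suc i) = quotient L (cs ∘ suc) r i

  quotient-closed : ∀ L cs r i → quotient (suc L) cs r i ≡ sumℕ (L ∸ i) (λ h → cs (i ℕ.+ suc h) * r ^ h)
  quotient-closed L       cs r zero    = ≡.refl
  quotient-closed zero    cs r (suc i) = ≡.refl
  quotient-closed (suc L) cs r (suc i) = quotient-closed L (cs ∘ suc) r i

  quotient-cong : ∀ L {cs ds : ℕ → Carrier} {r r′} → (∀ i → i < suc L → cs i ≈ ds i) → r ≈ r′ →
    ∀ i → quotient (suc L) cs r i ≈ quotient (suc L) ds r′ i
  quotient-cong zero    cs≈ds r≈r′ zero    = refl
  quotient-cong zero    cs≈ds r≈r′ (suc i) = refl
  quotient-cong (suc L) cs≈ds r≈r′ zero    = eval-cong (suc L) (λ i i< → cs≈ds (suc i) (s≤s i<)) r≈r′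
  quotient-cong (suc L) cs≈ds r≈r′ (suc i) = quotient-cong L (λ i i< → cs≈ds (suc i) (s≤s i<)) r≈r′ i

  quotient-leading : ∀ L cs r → quotient (suc (suc L)) cs r L ≈ cs (suc L)
  quotient-leading zero    cs r = trans (+-identityˡ _) (*-identityʳ _)
  quotient-leading (suc L) cs r = quotient-leading L (cs ∘ suc) r

  eval-division : ∀ L cs x r → eval (suc L) cs x ≈ (x - r) * eval L (quotient (suc L) cs r) x + eval (suc L) cs r
  eval-division zero    cs x r = solve 3 (λ x r a → a := (x :- r) :* con (+ 0) :+ a) refl x r _
  eval-division (suc L) cs x r = begin
    eval (suc (suc L)) cs x                          ≈⟨ eval-horner (suc L) cs x ⟩
    cs 0 + x * eval (suc L) (cs ∘ suc) x             ≈⟨ +-congˡ (*-congˡ (eval-division L (cs ∘ suc) x r)) ⟩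
    cs 0 + x * ((x - r) * eval L Q x + P)            ≈⟨ regroup x r (cs 0) P (eval L Q x) ⟩
    (x - r) * (P + x * eval L Q x) + (cs 0 + r * P)  ≈⟨ +-cong (*-congˡ (sym (eval-horner L (quotient (suc (suc L)) cs r) x))) (sym (eval-horner (suc L) cs r)) ⟩
    (x - r) * eval (suc L) (quotient (suc (suc L)) cs r) x + eval (suc (suc L)) cs r ∎
    where
    Q = quotient (suc L) (cs ∘ suc) r
    P = eval (suc L) (cs ∘ suc) r
    regroup : ∀ x r c₀ P Q → c₀ + x * ((x - r) * Q + P) ≈ (x - r) * (P + x * Q) + (c₀ + r * P)
    regroup = solve 5 (λ x r c₀ P Q → c₀ :+ x :* ((x :- r) :* Q :+ P) := (x :- r) :* (P :+ x :* Q) :+ (c₀ :+ r :* P)) refl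

  deriv : ℕ → (ℕ → Carrier) → Carrier → Carrier
  deriv L cs r = sumℕ L (λ i → (suc i ·ℕ cs (suc i)) * r ^ i)

  -- f = (X − r) Q + f(r) gives f′(r) = Q(r).
  eval-quotient-at-root : ∀ L cs r → eval L (quotient (suc L) cs r) r ≈ deriv L cs r
  eval-quotient-at-root zero    cs r = refl
  eval-quotient-at-root (suc L) cs r = begin
    eval (suc L) (quotient (suc (suc L)) cs r) r           ≈⟨ eval-horner L _ r ⟩
    eval (suc L) (cs ∘ suc) r + r * eval L (quotient (suc L) (cs ∘ suc) r) r ≈⟨ +-cong (sumℕ-head L _) (*-congˡ (eval-quotient-at-root L (cs ∘ suc) r)) ⟩
    (cs 1 * 1# + sumℕ L (λ i → cs (2 ℕ.+ i) * (r * r ^ i))) + r * deriv L (cs ∘ suc) r ≈⟨ +-congˡ (*-distribˡ-sumℕ L r _) ⟩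
    (cs 1 * 1# + sumℕ L (λ i → cs (2 ℕ.+ i) * (r * r ^ i))) + sumℕ L (λ i → r * ((suc i ·ℕ cs (2 ℕ.+ i)) * r ^ i)) ≈⟨ +-assoc _ _ _ ⟩
    cs 1 * 1# + (sumℕ L (λ i → cs (2 ℕ.+ i) * (r * r ^ i)) + sumℕ L (λ i → r * ((suc i ·ℕ cs (2 ℕ.+ i)) * r ^ i))) ≈⟨ +-cong (*-congʳ (sym (+-identityʳ _))) (sym (sumℕ-+ L _ _)) ⟩
    (cs 1 + 0#) * 1# + sumℕ L (λ i → cs (2 ℕ.+ i) * (r * r ^ i) + r * ((suc i ·ℕ cs (2 ℕ.+ i)) * r ^ i)) ≈⟨ +-congˡ (sumℕ-cong L (λ i _ → collect _ r _ _)) ⟩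
    (1 ·ℕ cs 1) * 1# + sumℕ L (λ i → (suc (suc i) ·ℕ cs (2 ℕ.+ i)) * (r * r ^ i)) ≈⟨ sym (sumℕ-head L _) ⟩
    deriv (suc L) cs r                                      ∎
    where
    collect : ∀ a r R M → a * (r * R) + r * (M * R) ≈ (a + M) * (r * R)
    collect = solve 4 (λ a r R M → a :* (r :* R) :+ r :* (M :* R) := (a :+ M) :* (r :* R)) refl

  eval-quotient-at-other-root : ∀ L cs {x r} → ¬ (x ≈ r) → eval (suc L) cs x ≈ 0# → eval (suc L) cs r ≈ 0# →
    eval L (quotient (suc L) cs r) x ≈ 0#
  eval-quotient-at-other-root L cs {x} {r} x≉r fx≈0 fr≈0 = x≉0∧x*y≈0⇒y≈0 (x≉r ∘ x-y≈0⇒x≈y _ _) (begin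
    (x - r) * eval L (quotient (suc L) cs r) x                        ≈⟨ sym (+-identityʳ _) ⟩
    (x - r) * eval L (quotient (suc L) cs r) x + 0#                   ≈⟨ +-congˡ (sym fr≈0) ⟩
    (x - r) * eval L (quotient (suc L) cs r) x + eval (suc L) cs r    ≈⟨ sym (eval-division L cs x r) ⟩
    eval (suc L) cs x                                                 ≈⟨ fx≈0 ⟩
    0#                                                                ∎)

  root∧quotient≈0⇒coefficients≈0 : ∀ L cs r → eval (suc L) cs r ≈ 0# →
    (∀ i → i < L → quotient (suc L) cs r i ≈ 0#) → ∀ i → i < suc L → cs i ≈ 0#
  root∧quotient≈0⇒coefficients≈0 zero cs r fr≈0 Q≈0 zero _ = trans (sym (trans (+-identityˡ _) (*-identityʳ _))) fr≈0
  root∧quotient≈0⇒coefficients≈0 zero cs r fr≈0 Q≈0 (suc i) (s≤s ())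
  root∧quotient≈0⇒coefficients≈0 (suc L) cs r fr≈0 Q≈0 zero _ = begin
    cs 0                                  ≈⟨ sym (trans (+-congˡ (trans (*-congˡ (Q≈0 0 (s≤s z≤n))) (zeroʳ r))) (+-identityʳ _)) ⟩
    cs 0 + r * eval (suc L) (cs ∘ suc) r  ≈⟨ sym (eval-horner (suc L) cs r) ⟩
    eval (suc (suc L)) cs r               ≈⟨ fr≈0 ⟩
    0#                                    ∎
  root∧quotient≈0⇒coefficients≈0 (suc L) cs r fr≈0 Q≈0 (suc i) (s≤s i<) =
    root∧quotient≈0⇒coefficients≈0 L (cs ∘ suc) r (Q≈0 0 (s≤s z≤n)) (λ j j< → Q≈0 (suc j) (s≤s j<)) i i<

  distinct-roots⇒coefficients≈0 : ∀ L cs (r : ℕ → Carrier) → (∀ i j → i < L → j < L → r i ≈ r j → i ≡ j) →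
    (∀ l → l < L → eval L cs (r l) ≈ 0#) → ∀ i → i < L → cs i ≈ 0#
  distinct-roots⇒coefficients≈0 (suc L) cs r r-injective roots =
    root∧quotient≈0⇒coefficients≈0 L cs (r L) (roots L (ℕ.n<1+n L))
      (distinct-roots⇒coefficients≈0 L (quotient (suc L) cs (r L)) r
        (λ i j i<L j<L → r-injective i j (ℕ.m<n⇒m<1+n i<L) (ℕ.m<n⇒m<1+n j<L)) quotient-roots)
    where
    quotient-roots : ∀ l → l < L → eval L (quotient (suc L) cs (r L)) (r l) ≈ 0#
    quotient-roots l l<L = eval-quotient-at-other-root L cs
      (λ e → ℕ.<-irrefl (r-injective l L (ℕ.m<n⇒m<1+n l<L) (ℕ.n<1+n L) e) l<L)
      (roots l (ℕ.m<n⇒m<1+n l<L)) (roots L (ℕ.n<1+n L))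

module FiniteField {c ℓ} (K : Field c ℓ) (N : ℕ) (size : FieldTheory.HasSize K N) where
  open FieldTheory K
  open FieldProperties K
  open ℤ-RingSolver commRing using (solve; _:=_; _:+_)
  open import Relation.Binary.Reasoning.Setoid setoid
  open import Algebra.Properties.Semiring.Mult semiring using (×1-homo-*)
  open import Algebra.Properties.CommutativeMonoid.Sum +-commutativeMonoid
    using (sum; sum-permute; sum-cong-≋; ∑-distrib-+; sum-replicate)

  enumerate : Fin N → Carrier
  enumerate = proj₁ size

  enumerate-injective : ∀ i j → enumerate i ≈ enumerate j → i ≡ j
  enumerate-injective = proj₁ (proj₂ size)

  index : Carrier → Fin N
  index x = proj₁ (proj₂ (proj₂ size) x)

  enumerate-index : ∀ x → enumerate (index x) ≈ x
  enumerate-index x = proj₂ (proj₂ (proj₂ size) x)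

  infix 4 _≟_
  _≟_ : ∀ x y → Dec (x ≈ y)
  x ≟ y with index x Fin.≟ index y
  ... | yes i≡j = yes (trans (sym (enumerate-index x)) (trans (reflexive (≡.cong enumerate i≡j)) (enumerate-index y)))
  ... | no  i≢j = no (λ x≈y → i≢j (enumerate-injective _ _ (trans (enumerate-index x) (trans x≈y (sym (enumerate-index y))))))

  -- Translation by 1 permutes the elements, so their sum S satisfies S ≈ S + N·1.
  N·1≈0 : N ·ℕ 1# ≈ 0#
  N·1≈0 = sym (+-cancelˡ (sum enumerate) 0# (N ·ℕ 1#) (begin
    sum enumerate + 0#                       ≈⟨ +-identityʳ _ ⟩
    sum enumerate                            ≈⟨ sum-permute enumerate (permutation (shift 1#) (shift (- 1#)) shift-back shift-forth) ⟩
    sum (enumerate ∘ shift 1#)               ≈⟨ sum-cong-≋ {N} (λ i → enumerate-index (enumerate i + 1#)) ⟩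
    sum (λ i → enumerate i + 1#)             ≈⟨ ∑-distrib-+ enumerate (λ _ → 1#) ⟩
    sum enumerate + sum (λ (_ : Fin N) → 1#) ≈⟨ +-congˡ (sum-replicate N) ⟩
    sum enumerate + N ·ℕ 1#                  ∎))
    where
    shift : Carrier → Fin N → Fin N
    shift a i = index (enumerate i + a)
    shift-cancel : ∀ a b → a + b ≈ 0# → ∀ i → shift a (shift b i) ≡ i
    shift-cancel a b a+b≈0 i = enumerate-injective _ _ (begin
      enumerate (shift a (shift b i))  ≈⟨ enumerate-index _ ⟩
      enumerate (shift b i) + a        ≈⟨ +-congʳ (enumerate-index _) ⟩
      (enumerate i + b) + a            ≈⟨ solve 3 (λ x b a → (x :+ b) :+ a := x :+ (a :+ b)) refl _ b a ⟩
      enumerate i + (a + b)            ≈⟨ +-congˡ a+b≈0 ⟩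
      enumerate i + 0#                 ≈⟨ +-identityʳ _ ⟩
      enumerate i                      ∎)
    shift-back : ∀ i → shift 1# (shift (- 1#) i) ≡ i
    shift-back = shift-cancel 1# (- 1#) (-‿inverseʳ 1#)
    shift-forth : ∀ i → shift (- 1#) (shift 1# i) ≡ i
    shift-forth = shift-cancel (- 1#) 1# (-‿inverseˡ 1#)

  p^M·1≈0⇒p·1≈0 : ∀ p M → (p ℕ.^ M) ·ℕ 1# ≈ 0# → p ·ℕ 1# ≈ 0#
  p^M·1≈0⇒p·1≈0 p zero    1≈0 = ⊥-elim (1≉0 (trans (sym (+-identityʳ 1#)) 1≈0))
  p^M·1≈0⇒p·1≈0 p (suc M) p^[1+M]·1≈0 with p ·ℕ 1# ≟ 0#
  ... | yes p·1≈0 = p·1≈0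
  ... | no  p·1≉0 = p^M·1≈0⇒p·1≈0 p M (x≉0∧x*y≈0⇒y≈0 p·1≉0 (trans (sym (×1-homo-* p (p ℕ.^ M))) p^[1+M]·1≈0))

  enumerateℕ : ℕ → Carrier
  enumerateℕ l with l ℕ.<? N
  ... | yes l<N = enumerate (Fin.fromℕ< l<N)
  ... | no  _   = 0#

  enumerateℕ-injective : ∀ i j → i < N → j < N → enumerateℕ i ≈ enumerateℕ j → i ≡ j
  enumerateℕ-injective i j i<N j<N with i ℕ.<? N | j ℕ.<? N
  ... | yes i<N′ | yes j<N′ = λ e → ≡.trans (≡.sym (Fin.toℕ-fromℕ< i<N′))
                                    (≡.trans (≡.cong toℕ (enumerate-injective _ _ e)) (Fin.toℕ-fromℕ< j<N′))
  ... | no  i≮N  | _        = ⊥-elim (i≮N i<N)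
  ... | yes _    | no  j≮N  = ⊥-elim (j≮N j<N)

  ∃≉0⊎∀≈0 : ∀ m (f : ℕ → Carrier) → (Σ ℕ λ i → i < m × ¬ (f i ≈ 0#)) ⊎ (∀ i → i < m → f i ≈ 0#)
  ∃≉0⊎∀≈0 zero    f = inj₂ (λ i ())
  ∃≉0⊎∀≈0 (suc m) f with ∃≉0⊎∀≈0 m f | f m ≟ 0#
  ... | inj₁ (i , i<m , fi≉0) | _         = inj₁ (i , ℕ.m<n⇒m<1+n i<m , fi≉0)
  ... | inj₂ _                | no fm≉0   = inj₁ (m , ℕ.n<1+n m , fm≉0)
  ... | inj₂ f≈0              | yes fm≈0  = inj₂ λ i i<1+m → case (ℕ.m≤n⇒m<n∨m≡n (ℕ.≤-pred i<1+m))
    where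
    case : ∀ {i} → i < m ⊎ i ≡ m → f i ≈ 0#
    case (inj₁ i<m)   = f≈0 _ i<m
    case (inj₂ ≡.refl) = fm≈0

prime∤m! : ∀ {p} → Prime p → ∀ m → m < p → ¬ p ∣ m !
prime∤m! p-prime zero    _   p∣1 with ∣1⇒≡1 p∣1
... | ≡.refl = ¬prime[1] p-prime
prime∤m! p-prime (suc m) m<p p∣m! with euclidsLemma (suc m) (m !) p-prime p∣m!
... | inj₁ p∣1+m = ℕ.<-irrefl ≡.refl (ℕ.<-≤-trans m<p (∣⇒≤ p∣1+m))
... | inj₂ p∣m!  = prime∤m! p-prime m (ℕ.<-trans (ℕ.n<1+n m) m<p) p∣m!

prime∣pCk : ∀ {p} → Prime p → ∀ k → 0 < k → k < p → p ∣ p C k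
prime∣pCk {p@(suc p-1)} p-prime k 0<k k<p with euclidsLemma (p C k) (k ! ℕ.* (p ∸ k) !) p-prime p∣pCk*k!*[p-k]!
  where
  pCk*k!*[p-k]!≡p! : (p C k) ℕ.* (k ! ℕ.* (p ∸ k) !) ≡ p !
  pCk*k!*[p-k]!≡p! = ≡.trans (≡.cong (ℕ._* (k ! ℕ.* (p ∸ k) !)) (nCk≡n!/k![n-k]! (ℕ.<⇒≤ k<p)))
                             (m/n*n≡m {{ℕ._!*_!≢0 k (p ∸ k)}} (k![n∸k]!∣n! (ℕ.<⇒≤ k<p)))
  p∣pCk*k!*[p-k]! : p ∣ (p C k) ℕ.* (k ! ℕ.* (p ∸ k) !)
  p∣pCk*k!*[p-k]! = ≡.subst (p ∣_) (≡.sym pCk*k!*[p-k]!≡p!) (divides (p-1 !) (ℕ.*-comm p (p-1 !)))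
... | inj₁ p∣pCk = p∣pCk
... | inj₂ p∣k!*[p-k]! with euclidsLemma (k !) ((p ∸ k) !) p-prime p∣k!*[p-k]!
...   | inj₁ p∣k!     = ⊥-elim (prime∤m! p-prime k k<p p∣k!)
...   | inj₂ p∣[p-k]! = ⊥-elim (prime∤m! p-prime (p ∸ k) (ℕ.∸-monoʳ-< 0<k (ℕ.<⇒≤ k<p)) p∣[p-k]!)

module Frobenius {c ℓ} (K : Field c ℓ) where
  open FieldTheory K
  open FieldProperties K
  open import Relation.Binary.Reasoning.Setoid setoid
  open import Algebra.Properties.Semiring.Mult semiring using (×-congʳ; ×-assoc-*; ×1-homo-*)
  open import Algebra.Properties.Semiring.Exp semiring using (^-assocʳ; ^-congˡ)
  open import Algebra.Properties.CommutativeSemiring.Exp commutativeSemiring using (^-distrib-*)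
  open import Algebra.Properties.CommutativeSemiring.Binomial commutativeSemiring
    using (theorem; binomialTerm)
  open import Algebra.Properties.Monoid.Sum +-monoid using (sum; sum-init-last; sum-cong-≋; sum-replicate-zero)

  Additive : ℕ → Set (c ⊔ ℓ)
  Additive e = ∀ x y → (x + y) ^ e ≈ x ^ e + y ^ e

  additive-* : ∀ a b → Additive a → Additive b → Additive (a ℕ.* b)
  additive-* a b a-additive b-additive x y = begin
    (x + y) ^ (a ℕ.* b)          ≈⟨ sym (^-assocʳ _ a b) ⟩
    ((x + y) ^ a) ^ b            ≈⟨ ^-congˡ b (a-additive x y) ⟩
    (x ^ a + y ^ a) ^ b          ≈⟨ b-additive _ _ ⟩
    (x ^ a) ^ b + (y ^ a) ^ b    ≈⟨ +-cong (^-assocʳ _ a b) (^-assocʳ _ a b) ⟩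
    x ^ (a ℕ.* b) + y ^ (a ℕ.* b) ∎

  additive-^ : ∀ a → Additive a → ∀ k → Additive (a ℕ.^ k)
  additive-^ a a-additive zero    x y = trans (*-identityʳ _) (+-cong (sym (*-identityʳ x)) (sym (*-identityʳ y)))
  additive-^ a a-additive (suc k) = additive-* a (a ℕ.^ k) a-additive (additive-^ a a-additive k)

  multiple-of-char·z≈0 : ∀ {p m} → p ·ℕ 1# ≈ 0# → p ∣ m → ∀ z → m ·ℕ z ≈ 0#
  multiple-of-char·z≈0 {p} p·1≈0 (divides d ≡.refl) z = begin
    (d ℕ.* p) ·ℕ z                ≈⟨ ×-congʳ (d ℕ.* p) (sym (*-identityˡ z)) ⟩
    (d ℕ.* p) ·ℕ (1# * z)         ≈⟨ sym (×-assoc-* (d ℕ.* p) 1# z) ⟩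
    ((d ℕ.* p) ·ℕ 1#) * z         ≈⟨ *-congʳ (×1-homo-* d p) ⟩
    ((d ·ℕ 1#) * (p ·ℕ 1#)) * z   ≈⟨ *-congʳ (*-congˡ p·1≈0) ⟩
    ((d ·ℕ 1#) * 0#) * z          ≈⟨ trans (*-congʳ (zeroʳ _)) (zeroˡ z) ⟩
    0#                            ∎

  -- (x + y)^p expands binomially and every middle coefficient p C k is divisible by p.
  frobenius-additive : ∀ p → Prime p → p ·ℕ 1# ≈ 0# → Additive p
  frobenius-additive 0 p-prime _ = ⊥-elim (¬prime[0] p-prime)
  frobenius-additive 1 p-prime _ = ⊥-elim (¬prime[1] p-prime)
  frobenius-additive p@(suc (suc m)) p-prime p·1≈0 x y = begin
    (x + y) ^ p                                                          ≈⟨ theorem p x y ⟩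
    term Fin.zero + sum (term ∘ Fin.suc)                                 ≈⟨ +-congˡ (sum-init-last (term ∘ Fin.suc)) ⟩
    term Fin.zero + (sum (term ∘ Fin.suc ∘ Fin.inject₁) + term (Fin.fromℕ p)) ≈⟨ +-congˡ (+-congʳ (trans (sum-cong-≋ {suc m} middle≈0) (sum-replicate-zero (suc m)))) ⟩
    term Fin.zero + (0# + term (Fin.fromℕ p))                            ≈⟨ +-cong first (trans (+-identityˡ _) last) ⟩
    y ^ p + x ^ p                                                        ≈⟨ +-comm _ _ ⟩
    x ^ p + y ^ p                                                        ∎
    where
    term = binomialTerm x y p
    middle≈0 : ∀ i → term (Fin.suc (Fin.inject₁ i)) ≈ 0#
    middle≈0 i = multiple-of-char·z≈0 p·1≈0 (prime∣pCk p-prime (suc (toℕ (Fin.inject₁ i))) (s≤s z≤n)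
      (s≤s (s≤s (≡.subst (_≤ m) (≡.sym (Fin.toℕ-inject₁ i)) (ℕ.≤-pred (Fin.toℕ<n i)))))) _
    first : term Fin.zero ≈ y ^ p
    first = trans (+-identityʳ _) (*-identityˡ _)
    last : term (Fin.fromℕ p) ≈ x ^ p
    last = begin
      term (Fin.fromℕ p)                   ≡⟨ ≡.cong (λ k → (p C k) ·ℕ (x ^ k * y ^ (p ∸ k))) (Fin.toℕ-fromℕ p) ⟩
      (p C p) ·ℕ (x ^ p * y ^ (p ∸ p))      ≡⟨ ≡.cong₂ (λ a b → a ·ℕ (x ^ p * y ^ b)) (nCn≡1 p) (ℕ.n∸n≡0 p) ⟩
      1 ·ℕ (x ^ p * 1#)                     ≈⟨ trans (+-identityʳ _) (*-identityʳ _) ⟩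
      x ^ p                                 ∎

  module AdditivePower {e : ℕ} (e-additive : Additive e) (0<e : 0 < e) where

    0^e≈0 : 0# ^ e ≈ 0#
    0^e≈0 = 0^n≈0 e 0<e

    ^-neg : ∀ x → (- x) ^ e ≈ - (x ^ e)
    ^-neg x = +-cancelˡ (x ^ e) _ _ (begin
      x ^ e + (- x) ^ e   ≈⟨ sym (e-additive x (- x)) ⟩
      (x - x) ^ e         ≈⟨ ^-congˡ e (-‿inverseʳ x) ⟩
      0# ^ e              ≈⟨ 0^e≈0 ⟩
      0#                  ≈⟨ sym (-‿inverseʳ (x ^ e)) ⟩
      x ^ e - x ^ e       ∎)

    ^-sumℕ : ∀ m (f : ℕ → Carrier) → sumℕ m f ^ e ≈ sumℕ m (λ i → f i ^ e)
    ^-sumℕ zero    f = 0^e≈0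
    ^-sumℕ (suc m) f = trans (e-additive _ _) (+-congʳ (^-sumℕ m f))

    ^-comm : ∀ x i → (x ^ i) ^ e ≈ (x ^ e) ^ i
    ^-comm x i = trans (^-assocʳ x i e) (trans (reflexive (≡.cong (x ^_) (ℕ.*-comm i e))) (sym (^-assocʳ x e i)))

    ^-eval : ∀ L cs x → eval L cs x ^ e ≈ eval L (λ i → cs i ^ e) (x ^ e)
    ^-eval L cs x = trans (^-sumℕ L _) (sumℕ-cong L (λ i _ → trans (^-distrib-* _ _ e) (*-congˡ (^-comm x i))))

    ^-quotient : ∀ L cs r i → quotient L cs r i ^ e ≈ quotient L (λ i → cs i ^ e) (r ^ e) i
    ^-quotient zero    cs r i       = 0^e≈0
    ^-quotient (suc L) cs r zero    = ^-eval L (cs ∘ suc) r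
    ^-quotient (suc L) cs r (suc i) = ^-quotient L (cs ∘ suc) r i

    ^-injective : (∀ x → Dec (x ≈ 0#)) → ∀ {x y} → x ^ e ≈ y ^ e → x ≈ y
    ^-injective _≟0 {x} {y} xᵉ≈yᵉ with (x - y) ≟0
    ... | yes x-y≈0 = x-y≈0⇒x≈y x y x-y≈0
    ... | no  x-y≉0 = ⊥-elim (^-≉0 e x-y≉0 (begin
      (x - y) ^ e        ≈⟨ e-additive x (- y) ⟩
      x ^ e + (- y) ^ e  ≈⟨ +-congˡ (^-neg y) ⟩
      x ^ e - y ^ e      ≈⟨ x≈y⇒x-y≈0 xᵉ≈yᵉ ⟩
      0#                 ∎))

module Extension {c ℓ} (K : Field c ℓ) (q n : ℕ) where
  open FieldTheory K
  open OverSubfield q n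
  open FieldProperties K
  open Frobenius K
  open ℤ-RingSolver commRing using (solve; _:=_; _:+_; _:*_; _:-_; :-_)
  open import Relation.Binary.Reasoning.Setoid setoid
  open import Algebra.Properties.Semiring.Exp semiring using (^-homo-*; ^-assocʳ; ^-congˡ)
  open import Algebra.Properties.CommutativeSemiring.Exp commutativeSemiring using (^-distrib-*)
  open import Algebra.Properties.Ring ring using (-‿distribʳ-*; -0#≈0#)

  kδ-refl : ∀ i → kδ i i ≈ 1#
  kδ-refl i with i ℕ.≟ i
  ... | yes _ = refl
  ... | no i≢i = ⊥-elim (i≢i ≡.refl)

  kδ-≢ : ∀ {i j} → ¬ i ≡ j → kδ i j ≈ 0#
  kδ-≢ {i} {j} i≢j with i ℕ.≟ j
  ... | yes i≡j = ⊥-elim (i≢j i≡j)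
  ... | no _    = refl

  eval-kδ : ∀ L b x → b < L → eval L (kδ b) x ≈ x ^ b
  eval-kδ L b x b<L = begin
    eval L (kδ b) x  ≈⟨ sumℕ-single L b b<L (λ i _ i≢b → trans (*-congʳ (kδ-≢ (i≢b ∘ ≡.sym))) (zeroˡ _)) ⟩
    kδ b b * x ^ b   ≈⟨ trans (*-congʳ (kδ-refl b)) (*-identityˡ _) ⟩
    x ^ b            ∎

  sumℕ-*kδ : ∀ m (f : ℕ → Carrier) j → j < m → sumℕ m (λ i → f i * kδ i j) ≈ f j
  sumℕ-*kδ m f j j<m = begin
    sumℕ m (λ i → f i * kδ i j)  ≈⟨ sumℕ-single m j j<m (λ i _ i≢j → trans (*-congˡ (kδ-≢ i≢j)) (zeroʳ _)) ⟩
    f j * kδ j j                 ≈⟨ trans (*-congˡ (kδ-refl j)) (*-identityʳ _) ⟩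
    f j                          ∎

  module FiniteExtension (q-primePower : IsPrimePower q) (size : HasSize (q ℕ.^ n)) where
    open FiniteField K (q ℕ.^ n) size

    private
      p = proj₁ q-primePower
      k = proj₁ (proj₂ q-primePower)
      p-prime : Prime p
      p-prime = proj₁ (proj₂ (proj₂ q-primePower))
      1≤k : 1 ≤ k
      1≤k = proj₁ (proj₂ (proj₂ (proj₂ q-primePower)))
      q≡p^k : q ≡ p ℕ.^ k
      q≡p^k = proj₂ (proj₂ (proj₂ (proj₂ q-primePower)))

    1<q : 1 < q
    1<q = ≡.subst (1 <_) (≡.sym q≡p^k) (ℕ.^-monoʳ-< p (ℕ.nonTrivial⇒n>1 p {{prime⇒nonTrivial p-prime}}) 1≤k)

    0<q^j : ∀ j → 0 < q ℕ.^ j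
    0<q^j = ℕ.m^n>0 q {{ℕ.>-nonZero (ℕ.<-trans (s≤s z≤n) 1<q)}}

    p·1≈0 : p ·ℕ 1# ≈ 0#
    p·1≈0 = p^M·1≈0⇒p·1≈0 p (k ℕ.* n)
      (trans (reflexive (≡.cong (_·ℕ 1#) (≡.trans (≡.sym (ℕ.^-*-assoc p k n)) (≡.cong (ℕ._^ n) (≡.sym q≡p^k))))) N·1≈0)

    q-additive : Additive q
    q-additive = ≡.subst Additive (≡.sym q≡p^k) (additive-^ p (frobenius-additive p p-prime p·1≈0) k)

    q^j-additive : ∀ j → Additive (q ℕ.^ j)
    q^j-additive = additive-^ q q-additive

    module Frob^ (j : ℕ) = AdditivePower (q^j-additive j) (0<q^j j)
    module Frob = AdditivePower q-additive (ℕ.<-trans (s≤s z≤n) 1<q)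

    InFq-resp : ∀ {x y} → InFq x → x ≈ y → InFq y
    InFq-resp x∈Fq x≈y = trans (^-congˡ q (sym x≈y)) (trans x∈Fq x≈y)

    InFq-0 : InFq 0#
    InFq-0 = Frob.0^e≈0

    InFq-1 : InFq 1#
    InFq-1 = 1^n≈1 q

    InFq-+ : ∀ {x y} → InFq x → InFq y → InFq (x + y)
    InFq-+ x∈Fq y∈Fq = trans (q-additive _ _) (+-cong x∈Fq y∈Fq)

    InFq-* : ∀ {x y} → InFq x → InFq y → InFq (x * y)
    InFq-* x∈Fq y∈Fq = trans (^-distrib-* _ _ q) (*-cong x∈Fq y∈Fq)

    InFq-neg : ∀ {x} → InFq x → InFq (- x)
    InFq-neg x∈Fq = trans (Frob.^-neg _) (-‿cong x∈Fq)

    InFq-sumℕ : ∀ m {f : ℕ → Carrier} → (∀ i → i < m → InFq (f i)) → InFq (sumℕ m f)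
    InFq-sumℕ zero    f∈Fq = InFq-0
    InFq-sumℕ (suc m) f∈Fq = InFq-+ (InFq-sumℕ m (λ i i<m → f∈Fq i (ℕ.m<n⇒m<1+n i<m))) (f∈Fq m (ℕ.n<1+n m))

    InFq-kδ : ∀ i j → InFq (kδ i j)
    InFq-kδ i j with i ℕ.≟ j
    ... | yes _ = InFq-1
    ... | no  _ = InFq-0

    InFq⇒^q^j≈ : ∀ {x} → InFq x → ∀ j → x ^ (q ℕ.^ j) ≈ x
    InFq⇒^q^j≈ {x} x∈Fq zero    = *-identityʳ x
    InFq⇒^q^j≈ {x} x∈Fq (suc j) = trans (sym (^-assocʳ x q (q ℕ.^ j))) (trans (^-congˡ (q ℕ.^ j) x∈Fq) (InFq⇒^q^j≈ x∈Fq j))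

    Tr-cong : ∀ {x y} → x ≈ y → Tr x ≈ Tr y
    Tr-cong x≈y = sumℕ-cong n (λ i _ → ^-congˡ (q ℕ.^ i) x≈y)

    Tr-+ : ∀ x y → Tr (x + y) ≈ Tr x + Tr y
    Tr-+ x y = trans (sumℕ-cong n (λ i _ → q^j-additive i x y)) (sumℕ-+ n _ _)

    Tr-0 : Tr 0# ≈ 0#
    Tr-0 = sumℕ-zero n (λ i _ → Frob^.0^e≈0 i)

    Tr-neg : ∀ x → Tr (- x) ≈ - Tr x
    Tr-neg x = trans (sumℕ-cong n (λ i _ → Frob^.^-neg i x)) (sumℕ-neg n _)

    Tr-sumℕ : ∀ m (f : ℕ → Carrier) → Tr (sumℕ m f) ≈ sumℕ m (λ i → Tr (f i))
    Tr-sumℕ zero    f = Tr-0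
    Tr-sumℕ (suc m) f = trans (Tr-+ _ _) (+-congʳ (Tr-sumℕ m f))

    Tr-*ˡ : ∀ {a} → InFq a → ∀ y → Tr (a * y) ≈ a * Tr y
    Tr-*ˡ {a} a∈Fq y = trans (sumℕ-cong n (λ i _ → trans (^-distrib-* a y (q ℕ.^ i)) (*-congʳ (InFq⇒^q^j≈ a∈Fq i))))
                             (sym (*-distribˡ-sumℕ n a _))

    Tr-linear : ∀ m (cs f : ℕ → Carrier) → (∀ i → i < m → InFq (cs i)) →
      Tr (sumℕ m (λ i → cs i * f i)) ≈ sumℕ m (λ i → cs i * Tr (f i))
    Tr-linear m cs f cs∈Fq = trans (Tr-sumℕ m _) (sumℕ-cong m (λ i i<m → Tr-*ˡ (cs∈Fq i i<m) (f i)))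

    -- Raising to the q-th power shifts the conjugates y^{q^i} in Tr y by one.
    Tr^q+y≈Tr+y^q^n : ∀ y → Tr y ^ q + y ≈ Tr y + y ^ (q ℕ.^ n)
    Tr^q+y≈Tr+y^q^n y = begin
      Tr y ^ q + y                      ≈⟨ +-cong (trans (Frob.^-sumℕ n conjugate) (sumℕ-cong n (λ i _ → conjugate-suc i))) (sym (*-identityʳ y)) ⟩
      sumℕ n (conjugate ∘ suc) + conjugate 0  ≈⟨ +-comm _ _ ⟩
      conjugate 0 + sumℕ n (conjugate ∘ suc)  ≈⟨ sym (sumℕ-head n conjugate) ⟩
      Tr y + y ^ (q ℕ.^ n)              ∎
      where
      conjugate : ℕ → Carrier
      conjugate i = y ^ (q ℕ.^ i)
      conjugate-suc : ∀ i → conjugate i ^ q ≈ conjugate (suc i)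
      conjugate-suc i = trans (^-assocʳ y (q ℕ.^ i) q) (reflexive (≡.cong (y ^_) (ℕ.*-comm (q ℕ.^ i) q)))

    Tr∈Fq⇒^q^n≈ : ∀ y → InFq (Tr y) → y ^ (q ℕ.^ n) ≈ y
    Tr∈Fq⇒^q^n≈ y Tr∈Fq = sym (+-cancelˡ (Tr y) y (y ^ (q ℕ.^ n)) (trans (+-congʳ (sym Tr∈Fq)) (Tr^q+y≈Tr+y^q^n y)))

    ^q^n≈⇒Tr∈Fq : ∀ y → y ^ (q ℕ.^ n) ≈ y → InFq (Tr y)
    ^q^n≈⇒Tr∈Fq y fixed = +-cancelʳ′ (trans (Tr^q+y≈Tr+y^q^n y) (+-congˡ fixed))
      where
      +-cancelʳ′ : ∀ {a b} → a + y ≈ b + y → a ≈ b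
      +-cancelʳ′ e = +-cancelˡ y _ _ (trans (+-comm _ _) (trans e (+-comm _ _)))

    -- Otherwise X^{q^s} − X would have all q^n > q^s elements as roots.
    ^q^s≉id : ∀ s → 1 ≤ s → s < n → ¬ (∀ y → y ^ (q ℕ.^ s) ≈ y)
    ^q^s≉id s 1≤s s<n fixed = 1≉0 (begin
      1#               ≈⟨ sym (trans (+-cong (kδ-refl d) (-‿cong (kδ-≢ (ℕ.<⇒≢ 1<d)))) (trans (+-congˡ -0#≈0#) (+-identityʳ _))) ⟩
      cs d             ≈⟨ distinct-roots⇒coefficients≈0 (suc d) cs enumerateℕ
                            (λ i j i< j< → enumerateℕ-injective i j (ℕ.<-≤-trans i< 1+d≤q^n) (ℕ.<-≤-trans j< 1+d≤q^n))
                            roots d (ℕ.n<1+n d) ⟩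
      0#               ∎)
      where
      d = q ℕ.^ s
      1+d≤q^n : suc d ≤ q ℕ.^ n
      1+d≤q^n = ℕ.^-monoʳ-< q 1<q s<n
      1<d : 1 < d
      1<d = ℕ.^-monoʳ-< q 1<q 1≤s
      cs : ℕ → Carrier
      cs i = kδ d i - kδ 1 i
      roots : ∀ l → l < suc d → eval (suc d) cs (enumerateℕ l) ≈ 0#
      roots l _ = begin
        eval (suc d) cs (enumerateℕ l)                                            ≈⟨ eval-- (suc d) (kδ d) (kδ 1) _ ⟩
        eval (suc d) (kδ d) (enumerateℕ l) - eval (suc d) (kδ 1) (enumerateℕ l)  ≈⟨ +-cong (eval-kδ (suc d) d _ (ℕ.n<1+n d)) (-‿cong (eval-kδ (suc d) 1 _ (s≤s (ℕ.<⇒≤ 1<d)))) ⟩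
        enumerateℕ l ^ d - enumerateℕ l ^ 1                                       ≈⟨ +-cong (fixed _) (-‿cong (*-identityʳ _)) ⟩
        enumerateℕ l - enumerateℕ l                                               ≈⟨ -‿inverseʳ _ ⟩
        0#                                                                        ∎

    InFqCoeffs : ℕ → (ℕ → Carrier) → Set ℓ
    InFqCoeffs m r = ∀ i → i < m → InFq (r i)

    powers-in-span : ∀ L {a lam} → 0 < L → InFqCoeffs L a → lam ^ L ≈ - eval L a lam →
      ∀ m → Σ (ℕ → Carrier) λ r → InFqCoeffs L r × (lam ^ m ≈ eval L r lam)
    powers-in-span (suc L) _ _ _ zero = kδ 0 , (λ i _ → InFq-kδ 0 i) , sym (eval-kδ (suc L) 0 _ (s≤s z≤n))
    powers-in-span (suc L) {a} {lam} 0<L a∈Fq λ^L≈ (suc m)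
      with powers-in-span (suc L) 0<L a∈Fq λ^L≈ m
    ... | r , r∈Fq , λ^m≈ = r′ , r′∈Fq , (begin
      lam * lam ^ m                              ≈⟨ *-congˡ λ^m≈ ⟩
      lam * (R + s * lam ^ L)                    ≈⟨ solve 4 (λ l R s P → l :* (R :+ s :* P) := l :* R :+ s :* (l :* P)) refl lam R s (lam ^ L) ⟩
      lam * R + s * lam ^ suc L                  ≈⟨ +-congˡ (*-congˡ (trans λ^L≈ (-‿cong (eval-horner L a lam)))) ⟩
      lam * R + s * (- (a 0 + lam * A))          ≈⟨ solve 5 (λ l R s a₀ A → l :* R :+ s :* (:- (a₀ :+ l :* A)) := :- (s :* a₀) :+ l :* (R :- s :* A)) refl lam R s (a 0) A ⟩
      - (s * a 0) + lam * (R - s * A)            ≈⟨ +-congˡ (*-congˡ (sym (trans (eval-- L r _ lam) (+-congˡ (-‿cong (eval-*ˡ L s (a ∘ suc) lam)))))) ⟩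
      r′ 0 + lam * eval L (r′ ∘ suc) lam         ≈⟨ sym (eval-horner L r′ lam) ⟩
      eval (suc L) r′ lam                        ∎)
      where
      s = r L
      R = eval L r lam
      A = eval L (a ∘ suc) lam
      r′ : ℕ → Carrier
      r′ zero    = - (s * a 0)
      r′ (suc i) = r i - s * a (suc i)
      r′∈Fq : InFqCoeffs (suc L) r′
      r′∈Fq zero    _        = InFq-neg (InFq-* (r∈Fq L (ℕ.n<1+n L)) (a∈Fq 0 (s≤s z≤n)))
      r′∈Fq (suc i) (s≤s i<) = InFq-+ (r∈Fq i (ℕ.m<n⇒m<1+n i<)) (InFq-neg (InFq-* (r∈Fq L (ℕ.n<1+n L)) (a∈Fq (suc i) (s≤s i<))))

    module PowerBasis (lam : Carrier) (generates : Generates lam) (a : ℕ → Carrier) (minimal : IsMinimalPolynomial a lam)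
                      (ds : ℕ → Carrier) (dual : IsDualBasisOfPowers lam ds) (1<n : 1 < n) where

      0<n : 0 < n
      0<n = ℕ.<-trans (s≤s z≤n) 1<n

      a-monic : a n ≈ 1#
      a-monic = proj₁ (proj₁ minimal)

      a∈Fq : InFqCoeffs n a
      a∈Fq = proj₂ (proj₁ minimal)

      f[λ]≈0 : eval (suc n) a lam ≈ 0#
      f[λ]≈0 = proj₁ (proj₂ minimal)

      Tr[ds₀]≈1 : Tr (lam ^ 0 * ds 0) ≈ 1#
      Tr[ds₀]≈1 = trans (dual 0 0 0<n 0<n) (kδ-refl 0)

      ds₀≉0 : ¬ (ds 0 ≈ 0#)
      ds₀≉0 ds₀≈0 = 1≉0 (trans (sym Tr[ds₀]≈1) (trans (Tr-cong (trans (*-congˡ ds₀≈0) (zeroʳ _))) Tr-0))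

      -- Tr(ds₀) = 1 and Tr(λ ds₀) = 0 lie in F_q, so ds₀ and λ ds₀ are fixed by y ↦ y^{q^n}.
      λ^q^n≈λ : lam ^ (q ℕ.^ n) ≈ lam
      λ^q^n≈λ = begin
        lam ^ Q               ≈⟨ sym (^-congˡ Q (*-identityʳ lam)) ⟩
        (lam ^ 1) ^ Q         ≈⟨ *-cancelʳ-≉0 ds₀≉0 (trans (*-congˡ (sym ds₀-fixed)) (trans (sym (^-distrib-* _ _ Q)) λds₀-fixed)) ⟩
        lam ^ 1               ≈⟨ *-identityʳ lam ⟩
        lam                   ∎
        where
        Q = q ℕ.^ n
        λds₀-fixed : (lam ^ 1 * ds 0) ^ Q ≈ lam ^ 1 * ds 0
        λds₀-fixed = Tr∈Fq⇒^q^n≈ _ (InFq-resp InFq-0 (sym (trans (dual 1 0 1<n 0<n) (kδ-≢ {1} {0} (λ ())))))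
        ds₀-fixed : ds 0 ^ Q ≈ ds 0
        ds₀-fixed = begin
          ds 0 ^ Q                ≈⟨ sym (trans (^-distrib-* _ _ Q) (trans (*-congʳ (1^n≈1 Q)) (*-identityˡ _))) ⟩
          (lam ^ 0 * ds 0) ^ Q    ≈⟨ Tr∈Fq⇒^q^n≈ _ (InFq-resp InFq-1 (sym Tr[ds₀]≈1)) ⟩
          1# * ds 0               ≈⟨ *-identityˡ _ ⟩
          ds 0                    ∎

      λ^n≈-f₀[λ] : lam ^ n ≈ - eval n a lam
      λ^n≈-f₀[λ] = +-cancelˡ (eval n a lam) _ _ (begin
        eval n a lam + lam ^ n           ≈⟨ +-congˡ (sym (trans (*-congʳ a-monic) (*-identityˡ _))) ⟩
        eval (suc n) a lam               ≈⟨ f[λ]≈0 ⟩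
        0#                               ≈⟨ sym (-‿inverseʳ _) ⟩
        eval n a lam - eval n a lam      ∎)

      span : ∀ y → Σ (ℕ → Carrier) λ r → InFqCoeffs n r × (y ≈ eval n r lam)
      span y with generates y
      ... | m , cs , cs∈Fq , y≈ = r , r∈Fq , (begin
        y                                     ≈⟨ y≈ ⟩
        sumℕ m (λ i → cs i * lam ^ i)         ≈⟨ sumℕ-cong m (λ i _ → *-congˡ (proj₂ (proj₂ (reduce i)))) ⟩
        sumℕ m (λ i → cs i * eval n (R i) lam) ≈⟨ sym (eval-sumℕ n m R cs lam) ⟩
        eval n r lam                          ∎)
        where
        reduce = powers-in-span n 0<n a∈Fq λ^n≈-f₀[λ]
        R : ℕ → ℕ → Carrier
        R i = proj₁ (reduce i)
        r : ℕ → Carrier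
        r j = sumℕ m (λ i → R i j * cs i)
        r∈Fq : InFqCoeffs n r
        r∈Fq j j<n = InFq-sumℕ m (λ i _ → InFq-* (proj₁ (proj₂ (reduce i)) j j<n) (cs∈Fq i))

      coordinates : ∀ r → InFqCoeffs n r → ∀ j → j < n → Tr (ds j * eval n r lam) ≈ r j
      coordinates r r∈Fq j j<n = begin
        Tr (ds j * eval n r lam)                      ≈⟨ Tr-cong (trans (*-distribˡ-sumℕ n _ _) (sumℕ-cong n (λ i _ → solve 3 (λ d r l → d :* (r :* l) := r :* (l :* d)) refl _ _ _))) ⟩
        Tr (sumℕ n (λ i → r i * (lam ^ i * ds j)))    ≈⟨ Tr-linear n r _ r∈Fq ⟩
        sumℕ n (λ i → r i * Tr (lam ^ i * ds j))      ≈⟨ sumℕ-cong n (λ i i<n → *-congˡ (dual i j i<n j<n)) ⟩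
        sumℕ n (λ i → r i * kδ i j)                   ≈⟨ sumℕ-*kδ n r j j<n ⟩
        r j                                           ∎

      expansion : ∀ y → y ≈ eval n (λ i → Tr (ds i * y)) lam
      expansion y with span y
      ... | r , r∈Fq , y≈ = trans y≈ (eval-cong n (λ i i<n → sym (trans (Tr-cong (*-congˡ y≈)) (coordinates r r∈Fq i i<n))) refl)

      independent : ∀ r → InFqCoeffs n r → eval n r lam ≈ 0# → ∀ j → j < n → r j ≈ 0#
      independent r r∈Fq r[λ]≈0 j j<n = trans (sym (coordinates r r∈Fq j j<n)) (trans (Tr-cong (trans (*-congˡ r[λ]≈0) (zeroʳ _))) Tr-0)

      ^q^s-fixes-all : ∀ s → lam ^ (q ℕ.^ s) ≈ lam → ∀ y → y ^ (q ℕ.^ s) ≈ y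
      ^q^s-fixes-all s λ-fixed y with span y
      ... | r , r∈Fq , y≈ = begin
        y ^ (q ℕ.^ s)                                ≈⟨ ^-congˡ (q ℕ.^ s) y≈ ⟩
        eval n r lam ^ (q ℕ.^ s)                     ≈⟨ Frob^.^-eval s n r lam ⟩
        eval n (λ i → r i ^ (q ℕ.^ s)) (lam ^ (q ℕ.^ s)) ≈⟨ eval-cong n (λ i i<n → InFq⇒^q^j≈ (r∈Fq i i<n) s) λ-fixed ⟩
        eval n r lam                                 ≈⟨ sym y≈ ⟩
        y                                            ∎

      Tr∈Fq : ∀ y → InFq (Tr y)
      Tr∈Fq y = ^q^n≈⇒Tr∈Fq y (^q^s-fixes-all n λ^q^n≈λ y)

      Tr-nondegenerate : ∀ w → (∀ k → k < n → Tr (lam ^ k * w) ≈ 0#) → w ≈ 0#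
      Tr-nondegenerate w Tr[λᵏw]≈0 with w ≟ 0#
      ... | yes w≈0 = w≈0
      ... | no  w≉0 with span (ds 0 * w ⁻¹)
      ...   | r , r∈Fq , ds₀/w≈ = ⊥-elim (1≉0 (begin
        1#                                       ≈⟨ sym Tr[ds₀]≈1 ⟩
        Tr (lam ^ 0 * ds 0)                      ≈⟨ Tr-cong (trans (*-identityˡ _) (sym (ds₀≈w*ds₀/w))) ⟩
        Tr (w * (ds 0 * w ⁻¹))                   ≈⟨ Tr-cong (*-congˡ ds₀/w≈) ⟩
        Tr (w * eval n r lam)                    ≈⟨ Tr-cong (trans (*-distribˡ-sumℕ n _ _) (sumℕ-cong n (λ i _ → solve 3 (λ w r l → w :* (r :* l) := r :* (l :* w)) refl _ _ _))) ⟩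
        Tr (sumℕ n (λ i → r i * (lam ^ i * w)))  ≈⟨ Tr-linear n r _ r∈Fq ⟩
        sumℕ n (λ i → r i * Tr (lam ^ i * w))    ≈⟨ sumℕ-zero n (λ i i<n → trans (*-congˡ (Tr[λᵏw]≈0 i i<n)) (zeroʳ _)) ⟩
        0#                                       ∎))
        where
        ds₀≈w*ds₀/w : w * (ds 0 * w ⁻¹) ≈ ds 0
        ds₀≈w*ds₀/w = begin
          w * (ds 0 * w ⁻¹)   ≈⟨ solve 3 (λ w d i → w :* (d :* i) := d :* (w :* i)) refl w (ds 0) (w ⁻¹) ⟩
          ds 0 * (w * w ⁻¹)   ≈⟨ *-congˡ (⁻¹-inv w w≉0) ⟩
          ds 0 * 1#           ≈⟨ *-identityʳ _ ⟩
          ds 0                ∎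

      conjugate : ℕ → Carrier
      conjugate j = lam ^ (q ℕ.^ j)

      -- λ^{q^i} = (λ^{q^s})^{q^i} with s = j − i forces λ^{q^s} = λ, hence y^{q^s} = y for all y.
      no-collision : ∀ {i j} → i < j → j < n → conjugate i ≈ conjugate j → ⊥
      no-collision {i} {j} i<j j<n λᵢ≈λⱼ = ^q^s≉id s (ℕ.m<n⇒0<n∸m i<j) (ℕ.≤-<-trans (ℕ.m∸n≤m j i) j<n)
        (^q^s-fixes-all s (sym (Frob^.^-injective i (_≟ 0#) (begin
          lam ^ (q ℕ.^ i)                 ≈⟨ λᵢ≈λⱼ ⟩
          lam ^ (q ℕ.^ j)                 ≡⟨ ≡.cong (λ e → lam ^ (q ℕ.^ e)) (≡.sym (ℕ.m+[n∸m]≡n (ℕ.<⇒≤ i<j))) ⟩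
          lam ^ (q ℕ.^ (i ℕ.+ s))         ≡⟨ ≡.cong (lam ^_) (≡.trans (ℕ.^-distribˡ-+-* q i s) (ℕ.*-comm (q ℕ.^ i) (q ℕ.^ s))) ⟩
          lam ^ (q ℕ.^ s ℕ.* q ℕ.^ i)     ≈⟨ sym (^-assocʳ lam (q ℕ.^ s) (q ℕ.^ i)) ⟩
          (lam ^ (q ℕ.^ s)) ^ (q ℕ.^ i)   ∎))))
        where s = j ∸ i

      conjugate-injective : ∀ i j → i < n → j < n → conjugate i ≈ conjugate j → i ≡ j
      conjugate-injective i j i<n j<n λᵢ≈λⱼ with ℕ.<-cmp i j
      ... | tri≈ _ i≡j _ = i≡j
      ... | tri< i<j _ _ = ⊥-elim (no-collision i<j j<n λᵢ≈λⱼ)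
      ... | tri> _ _ j<i = ⊥-elim (no-collision j<i i<n (sym λᵢ≈λⱼ))

      δ : Carrier
      δ = derivAt a lam

      a^q^j≈a : ∀ j i → i < suc n → a i ^ (q ℕ.^ j) ≈ a i
      a^q^j≈a j i i≤n with ℕ.m≤n⇒m<n∨m≡n (ℕ.≤-pred i≤n)
      ... | inj₁ i<n    = InFq⇒^q^j≈ (a∈Fq i i<n) j
      ... | inj₂ ≡.refl = trans (^-congˡ (q ℕ.^ j) a-monic) (trans (1^n≈1 (q ℕ.^ j)) (sym a-monic))

      f[conjugate]≈0 : ∀ j → eval (suc n) a (conjugate j) ≈ 0#
      f[conjugate]≈0 j = begin
        eval (suc n) a (conjugate j)                           ≈⟨ sym (eval-cong (suc n) (a^q^j≈a j) refl) ⟩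
        eval (suc n) (λ i → a i ^ (q ℕ.^ j)) (conjugate j)     ≈⟨ sym (Frob^.^-eval j (suc n) a lam) ⟩
        eval (suc n) a lam ^ (q ℕ.^ j)                         ≈⟨ ^-congˡ (q ℕ.^ j) f[λ]≈0 ⟩
        0# ^ (q ℕ.^ j)                                         ≈⟨ Frob^.0^e≈0 j ⟩
        0#                                                     ∎

      g : ℕ → Carrier
      g = quotient (suc n) a lam

      g-at : ℕ → ℕ → Carrier
      g-at j = quotient (suc n) a (conjugate j)

      g^q^j≈g-at : ∀ j i → g i ^ (q ℕ.^ j) ≈ g-at j i
      g^q^j≈g-at j i = trans (Frob^.^-quotient j (suc n) a lam i) (quotient-cong n (a^q^j≈a j) refl i)

      g-at[other-conjugate]≈0 : ∀ j l → j < n → l < n → ¬ j ≡ l → eval n (g-at j) (conjugate l) ≈ 0#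
      g-at[other-conjugate]≈0 j l j<n l<n j≢l = eval-quotient-at-other-root n a
        (λ λₗ≈λⱼ → j≢l (conjugate-injective j l j<n l<n (sym λₗ≈λⱼ))) (f[conjugate]≈0 l) (f[conjugate]≈0 j)

      g[λ]≈δ : eval n g lam ≈ δ
      g[λ]≈δ = eval-quotient-at-root n a lam

      g-at[conjugate]≈δ^q^j : ∀ j → eval n (g-at j) (conjugate j) ≈ δ ^ (q ℕ.^ j)
      g-at[conjugate]≈δ^q^j j = begin
        eval n (g-at j) (conjugate j)                       ≈⟨ sym (eval-cong n (λ i _ → g^q^j≈g-at j i) refl) ⟩
        eval n (λ i → g i ^ (q ℕ.^ j)) (conjugate j)        ≈⟨ sym (Frob^.^-eval j n g lam) ⟩
        eval n g lam ^ (q ℕ.^ j)                            ≈⟨ ^-congˡ (q ℕ.^ j) g[λ]≈δ ⟩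
        δ ^ (q ℕ.^ j)                                       ∎

      -- If f'(λ) = 0 then f/(X − λ), of degree n − 1, would vanish at all n conjugates.
      δ≉0 : ¬ (δ ≈ 0#)
      δ≉0 δ≈0 = 1≉0 (begin
        1#          ≈⟨ sym a-monic ⟩
        a n         ≈⟨ sym (lead n 0<n) ⟩
        g (n ∸ 1)   ≈⟨ distinct-roots⇒coefficients≈0 n g conjugate conjugate-injective roots (n ∸ 1) (ℕ.∸-monoʳ-< {n} {1} {0} (s≤s z≤n) 0<n) ⟩
        0#          ∎)
        where
        lead : ∀ m → 0 < m → quotient (suc m) a lam (m ∸ 1) ≈ a m
        lead (suc m) _ = quotient-leading m a lam
        roots : ∀ l → l < n → eval n g (conjugate l) ≈ 0#
        roots zero    _    = trans (eval-cong n (λ _ _ → refl) (*-identityʳ lam)) (trans g[λ]≈δ δ≈0)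
        roots (suc l) l<n = trans (eval-cong n (λ i _ → quotient-cong n (λ _ _ → refl) (sym (*-identityʳ lam)) i) refl)
                                  (g-at[other-conjugate]≈0 0 (suc l) 0<n l<n (λ ()))

      δ^q^j≉0 : ∀ j → ¬ (δ ^ (q ℕ.^ j) ≈ 0#)
      δ^q^j≉0 j = ^-≉0 (q ℕ.^ j) δ≉0

      δ⁻¹^q^j≈ : ∀ j → (δ ⁻¹) ^ (q ℕ.^ j) ≈ (δ ^ (q ℕ.^ j)) ⁻¹
      δ⁻¹^q^j≈ j = ⁻¹-unique (δ^q^j≉0 j)
        (trans (sym (^-distrib-* δ (δ ⁻¹) (q ℕ.^ j))) (trans (^-congˡ (q ℕ.^ j) (⁻¹-inv δ δ≉0)) (1^n≈1 (q ℕ.^ j))))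

      -- Lagrange interpolation: Σ_i (S_i − δ_{ki}) X^i has degree < n and vanishes at the n distinct
      -- conjugates, because the cofactor f/(X − λ^{q^j}) vanishes at every other conjugate.
      Tr[λᵏg/δ]≈kδ : ∀ k → k < n → ∀ i → i < n → Tr (lam ^ k * (g i * δ ⁻¹)) ≈ kδ k i
      Tr[λᵏg/δ]≈kδ k k<n i i<n = begin
        Tr (lam ^ k * (g i * δ ⁻¹))  ≈⟨ sumℕ-cong n (λ j _ → conjugate-term j) ⟩
        S i                          ≈⟨ x-y≈0⇒x≈y _ _ (distinct-roots⇒coefficients≈0 n (λ i → S i - kδ k i) conjugate conjugate-injective roots i i<n) ⟩
        kδ k i                       ∎
        where
        w : ℕ → Carrier
        w j = conjugate j ^ k * (δ ^ (q ℕ.^ j)) ⁻¹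
        S : ℕ → Carrier
        S i = sumℕ n (λ j → g-at j i * w j)
        conjugate-term : ∀ j → (lam ^ k * (g i * δ ⁻¹)) ^ (q ℕ.^ j) ≈ g-at j i * w j
        conjugate-term j = begin
          (lam ^ k * (g i * δ ⁻¹)) ^ e                  ≈⟨ ^-distrib-* _ _ e ⟩
          (lam ^ k) ^ e * (g i * δ ⁻¹) ^ e              ≈⟨ *-cong (Frob^.^-comm j lam k) (^-distrib-* _ _ e) ⟩
          conjugate j ^ k * (g i ^ e * (δ ⁻¹) ^ e)      ≈⟨ *-congˡ (*-cong (g^q^j≈g-at j i) (δ⁻¹^q^j≈ j)) ⟩
          conjugate j ^ k * (g-at j i * (δ ^ e) ⁻¹)     ≈⟨ solve 3 (λ a b c → a :* (b :* c) := b :* (a :* c)) refl _ _ _ ⟩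
          g-at j i * w j                                ∎
          where e = q ℕ.^ j
        roots : ∀ l → l < n → eval n (λ i → S i - kδ k i) (conjugate l) ≈ 0#
        roots l l<n = begin
          eval n (λ i → S i - kδ k i) (conjugate l)                                ≈⟨ eval-- n S (kδ k) _ ⟩
          eval n S (conjugate l) - eval n (kδ k) (conjugate l)                     ≈⟨ +-cong (eval-sumℕ n n g-at w (conjugate l)) (-‿cong (eval-kδ n k _ k<n)) ⟩
          sumℕ n (λ j → w j * eval n (g-at j) (conjugate l)) - conjugate l ^ k     ≈⟨ +-congʳ (sumℕ-single n l l<n (λ j j<n j≢l → trans (*-congˡ (g-at[other-conjugate]≈0 j l j<n l<n j≢l)) (zeroʳ _))) ⟩
          w l * eval n (g-at l) (conjugate l) - conjugate l ^ k                    ≈⟨ +-congʳ (*-congˡ (g-at[conjugate]≈δ^q^j l)) ⟩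
          (conjugate l ^ k * (δ ^ (q ℕ.^ l)) ⁻¹) * δ ^ (q ℕ.^ l) - conjugate l ^ k ≈⟨ +-congʳ (trans (*-assoc _ _ _) (trans (*-congˡ (trans (*-comm _ _) (⁻¹-inv _ (δ^q^j≉0 l)))) (*-identityʳ _))) ⟩
          conjugate l ^ k - conjugate l ^ k                                        ≈⟨ -‿inverseʳ _ ⟩
          0#                                                                       ∎

      ds≈g/δ : ∀ i → i < n → ds i ≈ g i * δ ⁻¹
      ds≈g/δ i i<n = x-y≈0⇒x≈y _ _ (Tr-nondegenerate _ (λ k k<n → begin
        Tr (lam ^ k * (ds i - g i * δ ⁻¹))                     ≈⟨ Tr-cong (distribˡ _ _ _) ⟩
        Tr (lam ^ k * ds i + lam ^ k * - (g i * δ ⁻¹))         ≈⟨ Tr-+ _ _ ⟩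
        Tr (lam ^ k * ds i) + Tr (lam ^ k * - (g i * δ ⁻¹))    ≈⟨ +-cong (dual k i k<n i<n) (trans (Tr-cong (sym (-‿distribʳ-* _ _))) (Tr-neg _)) ⟩
        kδ k i - Tr (lam ^ k * (g i * δ ⁻¹))                   ≈⟨ +-congˡ (-‿cong (Tr[λᵏg/δ]≈kδ k k<n i i<n)) ⟩
        kδ k i - kδ k i                                        ≈⟨ -‿inverseʳ _ ⟩
        0#                                                     ∎))

      Tr[dsᵢx]≈ : ∀ i → i < n → ∀ x → Tr (ds i * x) ≈ sumℕ n (λ j → ((δ ^ (q ℕ.^ j)) ⁻¹ * g i ^ (q ℕ.^ j)) * x ^ (q ℕ.^ j))
      Tr[dsᵢx]≈ i i<n x = sumℕ-cong n (λ j _ → term j)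
        where
        term : ∀ j → (ds i * x) ^ (q ℕ.^ j) ≈ ((δ ^ (q ℕ.^ j)) ⁻¹ * g i ^ (q ℕ.^ j)) * x ^ (q ℕ.^ j)
        term j = begin
          (ds i * x) ^ e                 ≈⟨ ^-congˡ e (*-congʳ (ds≈g/δ i i<n)) ⟩
          ((g i * δ ⁻¹) * x) ^ e         ≈⟨ ^-distrib-* _ _ e ⟩
          (g i * δ ⁻¹) ^ e * x ^ e       ≈⟨ *-congʳ (trans (^-distrib-* _ _ e) (trans (*-congˡ (δ⁻¹^q^j≈ j)) (*-comm _ _))) ⟩
          ((δ ^ e) ⁻¹ * g i ^ e) * x ^ e ∎
          where e = q ℕ.^ j

      λⁱgᵢ^q^j≈ : ∀ i j → lam ^ i * g i ^ (q ℕ.^ j) ≈ sumℕ (n ∸ i) (λ h → lam ^ (i ℕ.+ h ℕ.* q ℕ.^ j) * a (i ℕ.+ suc h) ^ (q ℕ.^ j))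
      λⁱgᵢ^q^j≈ i j = begin
        lam ^ i * g i ^ e                                             ≡⟨ ≡.cong (λ z → lam ^ i * z ^ e) (quotient-closed n a lam i) ⟩
        lam ^ i * sumℕ (n ∸ i) (λ h → a (i ℕ.+ suc h) * lam ^ h) ^ e  ≈⟨ *-congˡ (Frob^.^-sumℕ j (n ∸ i) _) ⟩
        lam ^ i * sumℕ (n ∸ i) (λ h → (a (i ℕ.+ suc h) * lam ^ h) ^ e) ≈⟨ *-distribˡ-sumℕ (n ∸ i) _ _ ⟩
        sumℕ (n ∸ i) (λ h → lam ^ i * (a (i ℕ.+ suc h) * lam ^ h) ^ e) ≈⟨ sumℕ-cong (n ∸ i) (λ h _ → term h) ⟩
        sumℕ (n ∸ i) (λ h → lam ^ (i ℕ.+ h ℕ.* e) * a (i ℕ.+ suc h) ^ e) ∎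
        where
        e = q ℕ.^ j
        term : ∀ h → lam ^ i * (a (i ℕ.+ suc h) * lam ^ h) ^ e ≈ lam ^ (i ℕ.+ h ℕ.* e) * a (i ℕ.+ suc h) ^ e
        term h = begin
          lam ^ i * (a (i ℕ.+ suc h) * lam ^ h) ^ e          ≈⟨ *-congˡ (trans (^-distrib-* _ _ e) (*-congˡ (^-assocʳ lam h e))) ⟩
          lam ^ i * (a (i ℕ.+ suc h) ^ e * lam ^ (h ℕ.* e))  ≈⟨ solve 3 (λ x y z → x :* (y :* z) := (x :* z) :* y) refl _ _ _ ⟩
          (lam ^ i * lam ^ (h ℕ.* e)) * a (i ℕ.+ suc h) ^ e  ≈⟨ *-congʳ (sym (^-homo-* lam i (h ℕ.* e))) ⟩
          lam ^ (i ℕ.+ h ℕ.* e) * a (i ℕ.+ suc h) ^ e        ∎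

      module _ (t : ℕ) (t≤n : t ≤ n) where

        t+k<n : ∀ k → k < n ∸ t → t ℕ.+ k < n
        t+k<n k k< = ≡.subst (t ℕ.+ k <_) (ℕ.m+[n∸m]≡n t≤n) (ℕ.+-monoʳ-< t k<)

        pPoly≈linPoly : ∀ x → pPoly lam ds t x ≈ linPoly (Acoef lam a δ t) x
        pPoly≈linPoly x = begin
          sumℕ m (λ k → lam ^ (t ℕ.+ k) * Tr (ds (t ℕ.+ k) * x))    ≈⟨ sumℕ-cong m (λ k k<m → *-congˡ (Tr[dsᵢx]≈ (t ℕ.+ k) (t+k<n k k<m) x)) ⟩
          sumℕ m (λ k → lam ^ (t ℕ.+ k) * sumℕ n (T k))             ≈⟨ sumℕ-cong m (λ k _ → *-distribˡ-sumℕ n _ _) ⟩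
          sumℕ m (λ k → sumℕ n (λ j → lam ^ (t ℕ.+ k) * T k j))     ≈⟨ sumℕ-comm m n _ ⟩
          sumℕ n (λ j → sumℕ m (λ k → lam ^ (t ℕ.+ k) * T k j))     ≈⟨ sumℕ-cong n (λ j _ → coefficient j) ⟩
          linPoly (Acoef lam a δ t) x                               ∎
          where
          m = n ∸ t
          T : ℕ → ℕ → Carrier
          T k j = ((δ ^ (q ℕ.^ j)) ⁻¹ * g (t ℕ.+ k) ^ (q ℕ.^ j)) * x ^ (q ℕ.^ j)
          coefficient : ∀ j → sumℕ m (λ k → lam ^ (t ℕ.+ k) * T k j) ≈ Acoef lam a δ t j * x ^ (q ℕ.^ j)
          coefficient j = begin
            sumℕ m (λ k → lam ^ (t ℕ.+ k) * T k j)                       ≈⟨ sumℕ-cong m (λ k _ → solve 4 (λ l d g X → l :* ((d :* g) :* X) := (d :* (l :* g)) :* X) refl _ _ _ _) ⟩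
            sumℕ m (λ k → (D * (lam ^ (t ℕ.+ k) * g (t ℕ.+ k) ^ e)) * X)  ≈⟨ sym (*-distribʳ-sumℕ m X _) ⟩
            sumℕ m (λ k → D * (lam ^ (t ℕ.+ k) * g (t ℕ.+ k) ^ e)) * X    ≈⟨ *-congʳ (sym (*-distribˡ-sumℕ m D _)) ⟩
            (D * sumℕ m (λ k → lam ^ (t ℕ.+ k) * g (t ℕ.+ k) ^ e)) * X    ≈⟨ *-congʳ (*-congˡ (sumℕ-cong m (λ k _ → λⁱgᵢ^q^j≈ (t ℕ.+ k) j))) ⟩
            Acoef lam a δ t j * X                                        ∎
            where
            e = q ℕ.^ j
            D = (δ ^ e) ⁻¹
            X = x ^ e

        eval-split : ∀ γ → eval n γ lam ≈ eval t γ lam + lam ^ t * eval (n ∸ t) (λ k → γ (t ℕ.+ k)) lam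
        eval-split γ = begin
          eval n γ lam                                                  ≡⟨ ≡.cong (λ z → eval z γ lam) (≡.sym (ℕ.m∸n+n≡m t≤n)) ⟩
          eval ((n ∸ t) ℕ.+ t) γ lam                                    ≈⟨ sumℕ-split t (n ∸ t) _ ⟩
          eval t γ lam + sumℕ (n ∸ t) (λ k → γ (t ℕ.+ k) * lam ^ (t ℕ.+ k)) ≈⟨ +-congˡ (trans (sumℕ-cong (n ∸ t) (λ k _ → term k)) (sym (*-distribˡ-sumℕ (n ∸ t) _ _))) ⟩
          eval t γ lam + lam ^ t * eval (n ∸ t) (λ k → γ (t ℕ.+ k)) lam ∎
          where
          term : ∀ k → γ (t ℕ.+ k) * lam ^ (t ℕ.+ k) ≈ lam ^ t * (γ (t ℕ.+ k) * lam ^ k)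
          term k = trans (*-congˡ (^-homo-* lam t k)) (solve 3 (λ g a b → g :* (a :* b) := a :* (g :* b)) refl _ _ _)

        sumℕ-λ^[t+k]≈ : ∀ β → sumℕ (n ∸ t) (λ k → lam ^ (t ℕ.+ k) * β k) ≈ lam ^ t * eval (n ∸ t) β lam
        sumℕ-λ^[t+k]≈ β = trans (sumℕ-cong (n ∸ t) (λ k _ → term k)) (sym (*-distribˡ-sumℕ (n ∸ t) _ _))
          where
          term : ∀ k → lam ^ (t ℕ.+ k) * β k ≈ lam ^ t * (β k * lam ^ k)
          term k = trans (*-congʳ (^-homo-* lam t k)) (solve 3 (λ a b g → (a :* b) :* g := a :* (g :* b)) refl _ _ _)

        -- (u, v) ↦ (u + λ^t v, λ^t v): the first coordinate reassembles x = Σ_{i<n} γ_i λ^i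
        -- from its low and high parts, the second is p(x) = λ^t Σ_{k<n−t} γ_{t+k} λ^k.
        M : Mat2
        M = mat 1# (lam ^ t) 0# (lam ^ t)

        det-M≉0 : ¬ (lam ≈ 0#) → ¬ (det M ≈ 0#)
        det-M≉0 lam≉0 det≈0 = ^-≉0 t lam≉0 (trans (sym det≈λ^t) det≈0)
          where
          det≈λ^t : 1# * lam ^ t - lam ^ t * 0# ≈ lam ^ t
          det≈λ^t = trans (+-cong (*-identityˡ _) (trans (-‿cong (zeroʳ _)) -0#≈0#)) (+-identityʳ _)

        concat : (ℕ → Carrier) → (ℕ → Carrier) → ℕ → Carrier
        concat α β i with i ℕ.<? t
        ... | yes _ = α i
        ... | no  _ = β (i ∸ t)

        concat-< : ∀ α β i → i < t → concat α β i ≡ α i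
        concat-< α β i i<t with i ℕ.<? t
        ... | yes _   = ≡.refl
        ... | no  i≮t = ⊥-elim (i≮t i<t)

        concat-+ : ∀ α β k → concat α β (t ℕ.+ k) ≡ β k
        concat-+ α β k with t ℕ.+ k ℕ.<? t
        ... | yes t+k<t = ⊥-elim (ℕ.<-irrefl ≡.refl (ℕ.<-≤-trans t+k<t (ℕ.m≤m+n t k)))
        ... | no  _     = ≡.cong β (ℕ.m+n∸m≡n t k)

        concat∈Fq : ∀ α β → InFqCoeffs t α → InFqCoeffs (n ∸ t) β → InFqCoeffs n (concat α β)
        concat∈Fq α β α∈Fq β∈Fq i i<n with i ℕ.<? t
        ... | yes i<t = α∈Fq i i<t
        ... | no  i≮t = β∈Fq (i ∸ t) (ℕ.∸-monoˡ-< i<n (ℕ.≮⇒≥ i≮t))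

        eval-concat : ∀ α β → eval t α lam + lam ^ t * eval (n ∸ t) β lam ≈ eval n (concat α β) lam
        eval-concat α β = trans (+-cong (eval-cong t (λ i i<t → reflexive (≡.sym (concat-< α β i i<t))) refl)
                                        (*-congˡ (eval-cong (n ∸ t) (λ k _ → reflexive (≡.sym (concat-+ α β k))) refl)))
                                (sym (eval-split (concat α β)))

        L⊆Lp : ∀ α β → AdmissibleCoeffs t α β →
          Σ Carrier λ x → ¬ (x ≈ 0#) × SamePoint (act M (Lvec lam t α β)) (x , pPoly lam ds t x)
        L⊆Lp α β (α∈Fq , β∈Fq , nonzero) = x , x≉0 , (1# , 1≉0 , sym (*-identityˡ x) , second)
          where
          γ = concat α β
          γ∈Fq = concat∈Fq α β α∈Fq β∈Fq
          x = 1# * eval t α lam + lam ^ t * eval (n ∸ t) β lam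
          x≈ : x ≈ eval n γ lam
          x≈ = trans (+-congʳ (*-identityˡ _)) (eval-concat α β)
          x≉0 : ¬ (x ≈ 0#)
          x≉0 x≈0 = [ (λ (i , i<t , αᵢ≉0) → αᵢ≉0 (trans (reflexive (≡.sym (concat-< α β i i<t))) (γ≈0 i (ℕ.<-≤-trans i<t t≤n))))
                    , (λ (k , k<m , βₖ≉0) → βₖ≉0 (trans (reflexive (≡.sym (concat-+ α β k))) (γ≈0 (t ℕ.+ k) (t+k<n k k<m)))) ]′ nonzero
            where γ≈0 = independent γ γ∈Fq (trans (sym x≈) x≈0)
          second : 0# * eval t α lam + lam ^ t * eval (n ∸ t) β lam ≈ 1# * pPoly lam ds t x
          second = begin
            0# * eval t α lam + lam ^ t * eval (n ∸ t) β lam        ≈⟨ trans (+-congʳ (zeroˡ _)) (+-identityˡ _) ⟩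
            lam ^ t * eval (n ∸ t) β lam                            ≈⟨ sym (sumℕ-λ^[t+k]≈ β) ⟩
            sumℕ (n ∸ t) (λ k → lam ^ (t ℕ.+ k) * β k)              ≈⟨ sumℕ-cong (n ∸ t) (λ k k<m → *-congˡ (sym (coordinate k k<m))) ⟩
            pPoly lam ds t x                                        ≈⟨ sym (*-identityˡ _) ⟩
            1# * pPoly lam ds t x                                   ∎
            where
            coordinate : ∀ k → k < n ∸ t → Tr (ds (t ℕ.+ k) * x) ≈ β k
            coordinate k k<m = trans (Tr-cong (*-congˡ x≈)) (trans (coordinates γ γ∈Fq (t ℕ.+ k) (t+k<n k k<m)) (reflexive (concat-+ α β k)))

        Lp⊆L : ∀ x → ¬ (x ≈ 0#) → Σ (ℕ → Carrier) λ α → Σ (ℕ → Carrier) λ β → AdmissibleCoeffs t α β ×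
          SamePoint (act M (Lvec lam t α β)) (x , pPoly lam ds t x)
        Lp⊆L x x≉0 = γ , (λ k → γ (t ℕ.+ k)) , ((λ i _ → Tr∈Fq _) , (λ i _ → Tr∈Fq _) , nonzero) , (1# , 1≉0 , first , second)
          where
          γ : ℕ → Carrier
          γ i = Tr (ds i * x)
          nonzero : (Σ ℕ λ i → i < t × ¬ (γ i ≈ 0#)) ⊎ (Σ ℕ λ k → k < n ∸ t × ¬ (γ (t ℕ.+ k) ≈ 0#))
          nonzero with ∃≉0⊎∀≈0 n γ
          ... | inj₂ γ≈0 = ⊥-elim (x≉0 (trans (expansion x) (sumℕ-zero n (λ i i<n → trans (*-congʳ (γ≈0 i i<n)) (zeroˡ _)))))
          ... | inj₁ (i , i<n , γᵢ≉0) with i ℕ.<? t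
          ...   | yes i<t = inj₁ (i , i<t , γᵢ≉0)
          ...   | no  i≮t = inj₂ (i ∸ t , ℕ.∸-monoˡ-< i<n (ℕ.≮⇒≥ i≮t) ,
                                  λ γ≈0 → γᵢ≉0 (trans (reflexive (≡.cong γ (≡.sym (ℕ.m+[n∸m]≡n (ℕ.≮⇒≥ i≮t))))) γ≈0))
          first : 1# * eval t γ lam + lam ^ t * eval (n ∸ t) (λ k → γ (t ℕ.+ k)) lam ≈ 1# * x
          first = trans (+-congʳ (*-identityˡ _)) (trans (sym (eval-split γ)) (trans (sym (expansion x)) (sym (*-identityˡ x))))
          second : 0# * eval t γ lam + lam ^ t * eval (n ∸ t) (λ k → γ (t ℕ.+ k)) lam ≈ 1# * pPoly lam ds t x
          second = trans (+-congʳ (zeroˡ _)) (trans (+-identityˡ _) (trans (sym (sumℕ-λ^[t+k]≈ _)) (sym (*-identityˡ _))))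

theorem5p2 : ∀ {c ℓ} (K : Field c ℓ) (q n : ℕ) →
    let open FieldTheory K in let open OverSubfield q n in
    IsPrimePower q → HasSize (q Data.Nat.^ n) →
    (lam : Carrier) → ¬ InFq lam → Generates lam →
    (a : ℕ → Carrier) → IsMinimalPolynomial a lam →
    (ds : ℕ → Carrier) → IsDualBasisOfPowers lam ds →
    (t : ℕ) → 1 ≤ t → t ≤ n ∸ 1 →
    PGLEquivalentToLp lam t (pPoly lam ds t) ×
    (∀ x → pPoly lam ds t x ≈ linPoly (Acoef lam a (derivAt a lam) t) x)
theorem5p2 K q n q-primePower size lam λ∉Fq generates a minimal ds dual t 1≤t t≤n-1 =
  (M t t≤n , det-M≉0 t t≤n λ≉0 , L⊆Lp t t≤n , Lp⊆L t t≤n) , pPoly≈linPoly t t≤n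
  where
  open FieldTheory K
  open Extension K q n
  open FiniteExtension q-primePower size
  t≤n : t ≤ n
  t≤n = ℕ.≤-trans t≤n-1 (ℕ.m∸n≤m n 1)
  1<n : 1 < n
  1<n = ℕ.m∸n≢0⇒n<m (λ n∸1≡0 → ℕ.<⇒≢ (ℕ.≤-trans 1≤t t≤n-1) (≡.sym n∸1≡0))
  open PowerBasis lam generates a minimal ds dual 1<n
  λ≉0 : ¬ (lam ≈ 0#)
  λ≉0 λ≈0 = λ∉Fq (InFq-resp InFq-0 (sym λ≈0))
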